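{- Let $n\geq4$ be even and let $\sigma\in D_n$ be a reflection with exactly two fixed points in $\{1,\dots,n\}$. Then (i) $\mathrm{fix}_{G_n}(\sigma) = 2^{(n+2)/2} - 2^{(n+8)/4}+1$ if $n\equiv0\pmod4$, and $\mathrm{fix}_{G_n}(\sigma) = 2^{(n+2)/2} - 2^{(n+6)/4}$ if $n\equiv2\pmod4$; (ii) for $m\geq3$ (with $m\le n$), $\mathrm{fix}_{G_{m,n}}(\sigma) = \binom{n/2}{m/2}-2\binom{\lfloor n/4\rfloor}{m/2}$ if $m$ is even, and $\mathrm{fix}_{G_{m,n}}(\sigma) = 2\binom{n/2-1}{\lfloor m/2\rfloor}-2\binom{\lfloor n/4\rfloor}{\lfloor m/2\rfloor}$ if $m$ is odd.
   Context: For $n\geq3$, let $T_n$ be the set of $n$-tuples $(a_1,\dots,a_n)$ with entries in $\{0,1\}$, positions regarded cyclically modulo $n$. A block of 0's of length $l$ is a sequence of $l$ cyclically consecutive positions (possibly wrapping around) all with entry $0$, not contained in a longer such sequence. With $k=\lfloor n/2\rfloor$, a block is bad if its length is at least $k-1$ ($n=2k$ even) or at least $k$ ($n=2k+1$ odd); a tuple is bad if it has a bad block (the all-zero tuple is bad), good otherwise. $G_n$ is the set of good tuples and $G_{m,n}$ the set of good tuples with exactly $m$ ones. $D_n$ is the dihedral group of permutations of $\{1,\dots,n\}$ consisting of the rotations $x\mapsto q+x \pmod n$ and reflections $x\mapsto q-x\pmod n$; it acts on $T_n$ by $\sigma\cdot(a_1,\dots,a_n)=(a_{\sigma^{ -1}(1)},\dots,a_{\sigma^{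 -1}(n)})$, preserving $G_n$ and $G_{m,n}$. For a set $X$ and $\sigma\in D_n$, $\mathrm{fix}_X(\sigma)$ is the number of $\mathbf a\in X$ with $\sigma\cdot\mathbf a=\mathbf a$. Binomial coefficients $\binom ab$ are $0$ unless $a,b$ are non-negative integers with $b\le a$. -}

module Defs where

open import Data.Bool using (Bool; true; false; not; _∧_; _∨_; if_then_else_)
open import Data.Nat using (ℕ; zero; suc; _+_; _∸_; _≡ᵇ_; _≤ᵇ_; _%_; _/_)
open import Data.Nat.DivMod using (_mod_)
open import Data.Fin using (Fin; toℕ)
open import Data.List using (List; []; _∷_; concatMap; map; upTo; length; filterᵇ; allFin)
open import Data.Bool.ListAction using (all; any)
open import Data.Vec.Functional using () renaming (_∷_ to _◂_)

-- An n-tuple with entries in {0,1}: true = 1, false = 0.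
-- Positions 0..n-1 (representing 1..n cyclically mod n).
Tuple : ℕ → Set
Tuple n = Fin n → Bool

allTuples : (n : ℕ) → List (Tuple n)
allTuples zero = (λ ()) ∷ []
allTuples (suc n) = concatMap (λ a → (false ◂ a) ∷ (true ◂ a) ∷ []) (allTuples n)

at : {n : ℕ} → Tuple n → ℕ → Bool
at {zero} a j = false
at {suc n} a j = a (j mod suc n)

zerosFrom : {n : ℕ} → Tuple n → ℕ → ℕ → Bool
zerosFrom a i l = all (λ r → not (at a (i + r))) (upTo l)

allZero : {n : ℕ} → Tuple n → Bool
allZero {n} a = zerosFrom a 0 n

-- a block of 0's of length l starting at position i (1 ≤ l < n):
-- l consecutive zeros, not contained in a longer run, i.e. positions
-- i-1 and i+l are 1.
isBlockAt : {n : ℕ} → Tuple n → ℕ → ℕ → Bool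
isBlockAt {n} a i l =
  (1 ≤ᵇ l) ∧ zerosFrom a i l ∧ at a (i + (n ∸ 1)) ∧ at a (i + l)

isEven : ℕ → Bool
isEven n = (n % 2) ≡ᵇ 0

threshold : ℕ → ℕ
threshold n = if isEven n then (n / 2) ∸ 1 else n / 2

isBad : {n : ℕ} → Tuple n → Bool
isBad {n} a = allZero a ∨
  any (λ i → any (λ l → (threshold n ≤ᵇ l) ∧ isBlockAt a i l) (upTo n)) (upTo n)

isGood : {n : ℕ} → Tuple n → Bool
isGood a = not (isBad a)

ones : {n : ℕ} → Tuple n → ℕ
ones {n} a = length (filterᵇ a (allFin n))

-- the reflection x ↦ q - x (mod n), as a function on positions
reflection : (n q : ℕ) → Fin n → Fin n
reflection zero q ()
reflection (suc n) q x = (q + (suc n ∸ toℕ x)) mod suc n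

numFixedPoints : (n q : ℕ) → ℕ
numFixedPoints n q = length (filterᵇ (λ x → toℕ (reflection n q x) ≡ᵇ toℕ x) (allFin n))

-- σ · a = a  where (σ·a)_i = a_{σ⁻¹(i)}; a reflection is an involution, so σ⁻¹ = σ.
isFixedBy : (n q : ℕ) → Tuple n → Bool
isFixedBy n q a = all (λ i → eqB (a (reflection n q i)) (a i)) (allFin n)
  where
  eqB : Bool → Bool → Bool
  eqB true true = true
  eqB false false = true
  eqB _ _ = false

fixG : (n q : ℕ) → ℕ
fixG n q = length (filterᵇ (λ a → isGood a ∧ isFixedBy n q a) (allTuples n))

fixGm : (m n q : ℕ) → ℕ
fixGm m n q = length (filterᵇ (λ a → isGood a ∧ (ones a ≡ᵇ m) ∧ isFixedBy n q a) (allTuples n))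

module Submission where

-- Write n = 2k + 2 and k = 2s + d with d ≤ 1, e = s + d. Having fixed points, σ is i ↦ 2p − i,
-- and rotating by −p turns it into i ↦ −i, whose fixed words are x c y (reverse c) with
-- letters x, y and a word c of length k. A tuple is bad (threshold k) exactly when it has k
-- cyclically consecutive zeros; for the word x c y (reverse c) this means c = 0, or x = 0 and
-- the first s letters of c vanish, or y = 0 and the last s letters of c vanish. Counting the
-- words c avoiding these three conditions, with or without a prescribed weight, by the
-- complement rule and inclusion–exclusion gives the formulas.

module Words where

  open import Data.Bool using (Bool; true; false; not; _∧_; _∨_)
  open import Data.Nat
  open import Data.Nat.Properties
  open import Data.Nat.Combinatorics using (_C_; nCk+nC[k+1]≡[n+1]C[k+1])
  open import Data.List using (List; []; _∷_; _++_; _∷ʳ_; length; take; drop)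
  open import Data.List.Properties using (length-++; take++drop≡id)
  open import Relation.Binary.PropositionalEquality
  open import Algebra.Properties.CommutativeSemigroup +-commutativeSemigroup using (interchange)

  bit : Bool → ℕ
  bit true = 1
  bit false = 0

  count : ℕ → (List Bool → Bool) → ℕ
  count zero P = bit (P [])
  count (suc n) P = count n (λ l → P (false ∷ l)) + count n (λ l → P (true ∷ l))

  count-ext : ∀ n {P Q : List Bool → Bool} → (∀ l → length l ≡ n → P l ≡ Q l) → count n P ≡ count n Q
  count-ext zero h = cong bit (h [] refl)
  count-ext (suc n) h = cong₂ _+_ (count-ext n (λ l e → h (false ∷ l) (cong suc e)))
                                  (count-ext n (λ l e → h (true ∷ l) (cong suc e)))

  count-false : ∀ n → count n (λ _ → false) ≡ 0
  count-false zero = refl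
  count-false (suc n) = cong₂ _+_ (count-false n) (count-false n)

  count-true : ∀ n → count n (λ _ → true) ≡ 2 ^ n
  count-true zero = refl
  count-true (suc n) = trans (cong₂ _+_ (count-true n) (count-true n)) (cong (2 ^ n +_) (sym (+-identityʳ (2 ^ n))))

  count-snoc : ∀ n P → count (suc n) P ≡ count n (λ l → P (l ∷ʳ false)) + count n (λ l → P (l ∷ʳ true))
  count-snoc zero P = refl
  count-snoc (suc n) P =
    trans (cong₂ _+_ (count-snoc n (λ l → P (false ∷ l))) (count-snoc n (λ l → P (true ∷ l))))
          (interchange (A false false) (A false true) (A true false) (A true true))
    where A : Bool → Bool → ℕ
          A x y = count n (λ l → P (x ∷ (l ∷ʳ y)))

  rotate : List Bool → List Bool
  rotate [] = []
  rotate (x ∷ xs) = xs ∷ʳ x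

  rotateBy : ℕ → List Bool → List Bool
  rotateBy zero l = l
  rotateBy (suc p) l = rotateBy p (rotate l)

  length-rotate : ∀ l → length (rotate l) ≡ length l
  length-rotate [] = refl
  length-rotate (x ∷ xs) = trans (length-++ xs) (+-comm (length xs) 1)

  -- Rotation permutes the words of a given length, so it preserves counts.
  count-rotateBy : ∀ p n P → count n (λ l → P (rotateBy p l)) ≡ count n P
  count-rotateBy zero n P = refl
  count-rotateBy (suc p) zero P = count-rotateBy p zero P
  count-rotateBy (suc p) (suc n) P =
    trans (sym (count-snoc n (λ l → P (rotateBy p l)))) (count-rotateBy p (suc n) P)

  count-guard : ∀ n b P → count n (λ l → b ∧ P l) ≡ bit b * count n P
  count-guard n true P = sym (+-identityʳ (count n P))
  count-guard n false P = count-false n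

  count-partition : ∀ n (P X : List Bool → Bool) →
    count n (λ l → P l ∧ not (X l)) + count n (λ l → P l ∧ X l) ≡ count n P
  count-partition zero P X with P [] | X []
  ... | true | true = refl
  ... | true | false = refl
  ... | false | _ = refl
  count-partition (suc n) P X =
    trans (interchange (C (λ l → P l ∧ not (X l)) false) (C (λ l → P l ∧ not (X l)) true)
                       (C (λ l → P l ∧ X l) false) (C (λ l → P l ∧ X l) true))
          (cong₂ _+_ (count-partition n (λ l → P (false ∷ l)) (λ l → X (false ∷ l)))
                     (count-partition n (λ l → P (true ∷ l)) (λ l → X (true ∷ l))))
    where C : (List Bool → Bool) → Bool → ℕ
          C R x = count n (λ l → R (x ∷ l))

  count-not : ∀ n X → count n (λ l → not (X l)) + count n X ≡ 2 ^ n
  count-not n X = trans (count-partition n (λ _ → true) X) (count-true n)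

  count-∨ : ∀ n P Q → count n (λ l → P l ∨ Q l) + count n (λ l → P l ∧ Q l) ≡ count n P + count n Q
  count-∨ zero P Q with P [] | Q []
  ... | true | true = refl
  ... | true | false = refl
  ... | false | true = refl
  ... | false | false = refl
  count-∨ (suc n) P Q =
    trans (interchange (C (λ l → P l ∨ Q l) false) (C (λ l → P l ∨ Q l) true)
                       (C (λ l → P l ∧ Q l) false) (C (λ l → P l ∧ Q l) true))
    (trans (cong₂ _+_ (count-∨ n (λ l → P (false ∷ l)) (λ l → Q (false ∷ l)))
                      (count-∨ n (λ l → P (true ∷ l)) (λ l → Q (true ∷ l))))
           (interchange (C P false) (C Q false) (C P true) (C Q true)))
    where C : (List Bool → Bool) → Bool → ℕ
          C R x = count n (λ l → R (x ∷ l))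

  count-split : ∀ a b F G → count (a + b) (λ l → F (take a l) ∧ G (drop a l)) ≡ count a F * count b G
  count-split zero b F G = count-guard b (F []) G
  count-split (suc a) b F G =
    trans (cong₂ _+_ (count-split a b (λ l → F (false ∷ l)) G) (count-split a b (λ l → F (true ∷ l)) G))
          (sym (*-distribʳ-+ (count b G) (count a (λ l → F (false ∷ l))) (count a (λ l → F (true ∷ l)))))

  allFalse : List Bool → Bool
  allFalse [] = true
  allFalse (x ∷ xs) = not x ∧ allFalse xs

  count-allFalse : ∀ n → count n allFalse ≡ 1
  count-allFalse zero = refl
  count-allFalse (suc n) = cong₂ _+_ (count-allFalse n) (count-false n)

  weight : List Bool → ℕ
  weight [] = 0
  weight (x ∷ xs) = bit x + weight xs

  weight-++ : ∀ u v → weight (u ++ v) ≡ weight u + weight v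
  weight-++ [] v = refl
  weight-++ (x ∷ u) v = trans (cong (bit x +_) (weight-++ u v)) (sym (+-assoc (bit x) (weight u) (weight v)))

  weight-allFalse : ∀ u → allFalse u ≡ true → weight u ≡ 0
  weight-allFalse [] _ = refl
  weight-allFalse (false ∷ u) e = weight-allFalse u e

  weight-rotateBy : ∀ p l → weight (rotateBy p l) ≡ weight l
  weight-rotateBy zero l = refl
  weight-rotateBy (suc p) [] = weight-rotateBy p []
  weight-rotateBy (suc p) (x ∷ l) =
    trans (weight-rotateBy p (l ∷ʳ x))
          (trans (weight-++ l (x ∷ [])) (trans (cong (weight l +_) (+-identityʳ (bit x))) (+-comm (weight l) (bit x))))

  -- Pascal's rule makes the number of words of length n and weight j the binomial coefficient.
  count-weight : ∀ n j → count n (λ l → weight l ≡ᵇ j) ≡ n C j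
  count-weight zero zero = refl
  count-weight zero (suc j) = refl
  count-weight (suc n) zero = trans (cong₂ _+_ (count-weight n 0) (count-false n)) (+-identityʳ (n C 0))
  count-weight (suc n) (suc j) = trans (cong₂ _+_ (count-weight n (suc j)) (count-weight n j))
                                       (trans (+-comm (n C suc j) (n C j)) (nCk+nC[k+1]≡[n+1]C[k+1] n j))

  count-zeroPrefix : ∀ a b G → count (a + b) (λ l → allFalse (take a l) ∧ G (drop a l)) ≡ count b G
  count-zeroPrefix a b G = trans (count-split a b allFalse G) (trans (cong (_* count b G) (count-allFalse a)) (+-identityʳ (count b G)))

  count-zeroSuffix : ∀ a b F → count (a + b) (λ l → F (take a l) ∧ allFalse (drop a l)) ≡ count a F
  count-zeroSuffix a b F = trans (count-split a b F allFalse) (trans (cong (count a F *_) (count-allFalse b)) (*-identityʳ (count a F)))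

  weight-take-drop : ∀ a l → weight l ≡ weight (take a l) + weight (drop a l)
  weight-take-drop a l = trans (cong weight (sym (take++drop≡id a l))) (weight-++ (take a l) (drop a l))

  weight-zeroPrefix : ∀ a l → allFalse (take a l) ≡ true → weight l ≡ weight (drop a l)
  weight-zeroPrefix a l z = trans (weight-take-drop a l) (cong (_+ weight (drop a l)) (weight-allFalse (take a l) z))

  weight-zeroSuffix : ∀ a l → allFalse (drop a l) ≡ true → weight l ≡ weight (take a l)
  weight-zeroSuffix a l z = trans (weight-take-drop a l) (trans (cong (weight (take a l) +_) (weight-allFalse (drop a l) z)) (+-identityʳ _))

module Lookup where

  open import Data.Bool using (Bool; true; false; not; _∧_; _∨_; T)
  open import Data.Nat
  open import Data.Nat.Properties
  open import Data.List using (List; []; _∷_; _++_; _∷ʳ_; length; reverse; take; drop; applyUpTo)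
  open import Data.List.Properties using (length-reverse; unfold-reverse)
  open import Data.Bool.ListAction using (all; any)
  open import Data.Product using (Σ; _,_; _×_; proj₁; proj₂)
  open import Data.Sum using (_⊎_; inj₁; inj₂)
  open import Relation.Nullary using (yes; no)
  open import Relation.Binary.PropositionalEquality
  open Words using (allFalse)

  ∧-true : ∀ {a b} → a ∧ b ≡ true → a ≡ true × b ≡ true
  ∧-true {true} {true} _ = refl , refl

  ∨-true : ∀ {a b} → a ∨ b ≡ true → a ≡ true ⊎ b ≡ true
  ∨-true {true} _ = inj₁ refl
  ∨-true {false} e = inj₂ e

  not-true : ∀ {a} → not a ≡ true → a ≡ false
  not-true {false} _ = refl

  not-false : ∀ {a} → not a ≡ false → a ≡ true
  not-false {true} _ = refl

  false⇒not : ∀ {a} → a ≡ false → not a ≡ true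
  false⇒not refl = refl

  true≢false : true ≡ false → ∀ {A : Set} → A
  true≢false ()

  T⇒true : ∀ {b} → T b → b ≡ true
  T⇒true {true} _ = refl

  true⇒T : ∀ {b} → b ≡ true → T b
  true⇒T refl = _

  bool-ext : ∀ {b c : Bool} → (b ≡ true → c ≡ true) → (c ≡ true → b ≡ true) → b ≡ c
  bool-ext {true} {true} _ _ = refl
  bool-ext {true} {false} f _ = sym (f refl)
  bool-ext {false} {true} _ g = g refl
  bool-ext {false} {false} _ _ = refl

  all-true : ∀ n (g : ℕ → ℕ) (p : ℕ → Bool) → all p (applyUpTo g n) ≡ true → ∀ r → r < n → p (g r) ≡ true
  all-true (suc n) g p e zero _ = proj₁ (∧-true e)
  all-true (suc n) g p e (suc r) (s≤s lt) = all-true n (λ x → g (suc x)) p (proj₂ (∧-true {p (g 0)} e)) r lt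

  true-all : ∀ n (g : ℕ → ℕ) (p : ℕ → Bool) → (∀ r → r < n → p (g r) ≡ true) → all p (applyUpTo g n) ≡ true
  true-all zero g p h = refl
  true-all (suc n) g p h = cong₂ _∧_ (h 0 z<s) (true-all n (λ x → g (suc x)) p (λ r lt → h (suc r) (s≤s lt)))

  all-false : ∀ n (g : ℕ → ℕ) (p : ℕ → Bool) → all p (applyUpTo g n) ≡ false → Σ ℕ λ r → r < n × p (g r) ≡ false
  all-false (suc n) g p e with p (g 0) in eq
  ... | false = 0 , z<s , eq
  ... | true with all-false n (λ x → g (suc x)) p e
  ...   | r , lt , pr = suc r , s≤s lt , pr

  any-true : ∀ n (g : ℕ → ℕ) (p : ℕ → Bool) → any p (applyUpTo g n) ≡ true → Σ ℕ λ r → r < n × p (g r) ≡ true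
  any-true (suc n) g p e with p (g 0) in eq
  ... | true = 0 , z<s , eq
  ... | false with any-true n (λ x → g (suc x)) p e
  ...   | r , lt , pr = suc r , s≤s lt , pr

  true-any : ∀ n (g : ℕ → ℕ) (p : ℕ → Bool) r → r < n → p (g r) ≡ true → any p (applyUpTo g n) ≡ true
  true-any (suc n) g p zero _ e rewrite e = refl
  true-any (suc n) g p (suc r) (s≤s lt) e with p (g 0)
  ... | true = refl
  ... | false = true-any n (λ x → g (suc x)) p r lt e

  all-ext : ∀ {A : Set} (xs : List A) {p q : A → Bool} → (∀ x → p x ≡ q x) → all p xs ≡ all q xs
  all-ext [] h = refl
  all-ext (x ∷ xs) h = cong₂ _∧_ (h x) (all-ext xs h)

  any-ext : ∀ {A : Set} (xs : List A) {p q : A → Bool} → (∀ x → p x ≡ q x) → any p xs ≡ any q xs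
  any-ext [] h = refl
  any-ext (x ∷ xs) h = cong₂ _∨_ (h x) (any-ext xs h)

  -- Lookup in a word, with the default letter false outside its range.
  get : List Bool → ℕ → Bool
  get [] _ = false
  get (x ∷ xs) zero = x
  get (x ∷ xs) (suc j) = get xs j

  get-++ˡ : ∀ u v j → j < length u → get (u ++ v) j ≡ get u j
  get-++ˡ (x ∷ u) v zero _ = refl
  get-++ˡ (x ∷ u) v (suc j) (s≤s lt) = get-++ˡ u v j lt

  get-++ʳ : ∀ u v j → get (u ++ v) (length u + j) ≡ get v j
  get-++ʳ [] v j = refl
  get-++ʳ (x ∷ u) v j = get-++ʳ u v j

  get-beyond : ∀ u j → length u ≤ j → get u j ≡ false
  get-beyond [] j _ = refl
  get-beyond (x ∷ u) (suc j) (s≤s le) = get-beyond u j le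

  get-take : ∀ s u j → j < s → get (take s u) j ≡ get u j
  get-take (suc s) [] j _ = refl
  get-take (suc s) (x ∷ u) zero _ = refl
  get-take (suc s) (x ∷ u) (suc j) (s≤s lt) = get-take s u j lt

  get-take-beyond : ∀ s u j → s ≤ j → get (take s u) j ≡ false
  get-take-beyond zero u j _ = refl
  get-take-beyond (suc s) [] j _ = refl
  get-take-beyond (suc s) (x ∷ u) (suc j) (s≤s le) = get-take-beyond s u j le

  get-drop : ∀ e u j → get (drop e u) j ≡ get u (e + j)
  get-drop zero u j = refl
  get-drop (suc e) [] j = refl
  get-drop (suc e) (x ∷ u) j = get-drop e u j

  ∸-suc : ∀ M j → j < M → M ∸ j ≡ suc (M ∸ suc j)
  ∸-suc (suc M) zero _ = refl
  ∸-suc (suc M) (suc j) (s≤s lt) = ∸-suc M j lt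

  get-reverse : ∀ m j → j < length m → get (reverse m) j ≡ get m (length m ∸ suc j)
  get-reverse (x ∷ m) j lt rewrite unfold-reverse x m with j <? length m
  ... | yes j<m = trans (get-++ˡ (reverse m) (x ∷ []) j (subst (j <_) (sym (length-reverse m)) j<m))
                   (trans (get-reverse m j j<m) (cong (get (x ∷ m)) (sym (∸-suc (length m) j j<m))))
  ... | no j≮m = trans (cong (get (reverse m ∷ʳ x)) (trans j≡ (trans (sym (length-reverse m)) (sym (+-identityʳ _)))))
                 (trans (get-++ʳ (reverse m) (x ∷ []) 0)
                        (cong (get (x ∷ m)) (sym (trans (cong (length m ∸_) j≡) (n∸n≡0 (length m))))))
    where j≡ : j ≡ length m
          j≡ = ≤-antisym (≤-pred lt) (≮⇒≥ j≮m)

  get-ext : ∀ u v → length u ≡ length v → (∀ j → j < length u → get u j ≡ get v j) → u ≡ v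
  get-ext [] [] _ _ = refl
  get-ext (x ∷ u) (y ∷ v) e h = cong₂ _∷_ (h 0 z<s) (get-ext u v (suc-injective e) (λ j lt → h (suc j) (s≤s lt)))

  allFalse⇒get : ∀ u → allFalse u ≡ true → ∀ j → get u j ≡ false
  allFalse⇒get [] e j = refl
  allFalse⇒get (x ∷ u) e zero = not-true (proj₁ (∧-true {not x} e))
  allFalse⇒get (x ∷ u) e (suc j) = allFalse⇒get u (proj₂ (∧-true {not x} e)) j

  get⇒allFalse : ∀ u → (∀ j → get u j ≡ false) → allFalse u ≡ true
  get⇒allFalse [] h = refl
  get⇒allFalse (x ∷ u) h = cong₂ _∧_ (false⇒not (h 0)) (get⇒allFalse u (λ j → h (suc j)))

  allFalse-take⇒ : ∀ s u → allFalse (take s u) ≡ true → ∀ j → j < s → get u j ≡ false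
  allFalse-take⇒ s u e j lt = trans (sym (get-take s u j lt)) (allFalse⇒get (take s u) e j)

  allFalse-take⇐ : ∀ s u → (∀ j → j < s → get u j ≡ false) → allFalse (take s u) ≡ true
  allFalse-take⇐ s u h = get⇒allFalse (take s u) letter
    where letter : ∀ j → get (take s u) j ≡ false
          letter j with j <? s
          ... | yes lt = trans (get-take s u j lt) (h j lt)
          ... | no j≮s = get-take-beyond s u j (≮⇒≥ j≮s)

  allFalse-drop⇒ : ∀ e u → allFalse (drop e u) ≡ true → ∀ j → e ≤ j → get u j ≡ false
  allFalse-drop⇒ e u z j le with m≤n⇒∃[o]m+o≡n le
  ... | g , refl = trans (sym (get-drop e u g)) (allFalse⇒get (drop e u) z g)

  allFalse-drop⇐ : ∀ e u → (∀ j → e ≤ j → get u j ≡ false) → allFalse (drop e u) ≡ true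
  allFalse-drop⇐ e u h = get⇒allFalse (drop e u) (λ j → trans (get-drop e u j) (h (e + j) (m≤m+n e j)))

module Palindromes where

  open import Data.Bool using (Bool; true; false; _∧_)
  open import Data.Bool.Properties using (∧-assoc; ∧-comm)
  open import Data.Nat
  open import Data.Nat.Properties
  open import Data.List using (List; []; _∷_; _++_; _∷ʳ_; length; reverse)
  open import Data.List.Properties using (++-assoc; length-reverse; reverse-++; unfold-reverse)
  open import Relation.Binary.PropositionalEquality
  open Words

  _==_ : Bool → Bool → Bool
  true == true = true
  false == false = true
  _ == _ = false

  ==⇒≡ : ∀ {x y} → x == y ≡ true → x ≡ y
  ==⇒≡ {true} {true} _ = refl
  ==⇒≡ {false} {false} _ = refl

  ≡⇒== : ∀ {x y} → x ≡ y → x == y ≡ true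
  ≡⇒== {true} refl = refl
  ≡⇒== {false} refl = refl

  sameWord : List Bool → List Bool → Bool
  sameWord [] [] = true
  sameWord (x ∷ xs) (y ∷ ys) = (x == y) ∧ sameWord xs ys
  sameWord _ _ = false

  sameWord⇒≡ : ∀ {u v} → sameWord u v ≡ true → u ≡ v
  sameWord⇒≡ {[]} {[]} _ = refl
  sameWord⇒≡ {x ∷ u} {y ∷ v} e with x == y in exy
  ... | true = cong₂ _∷_ (==⇒≡ exy) (sameWord⇒≡ e)

  ≡⇒sameWord : ∀ {u v} → u ≡ v → sameWord u v ≡ true
  ≡⇒sameWord {[]} refl = refl
  ≡⇒sameWord {x ∷ u} refl = cong₂ _∧_ (≡⇒== {x} refl) (≡⇒sameWord {u} refl)

  sameWord-snoc : ∀ u v a b → length u ≡ length v → sameWord (u ∷ʳ a) (v ∷ʳ b) ≡ sameWord u v ∧ (a == b)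
  sameWord-snoc [] [] true true _ = refl
  sameWord-snoc [] [] true false _ = refl
  sameWord-snoc [] [] false true _ = refl
  sameWord-snoc [] [] false false _ = refl
  sameWord-snoc (x ∷ u) (y ∷ v) a b e =
    trans (cong ((x == y) ∧_) (sameWord-snoc u v a b (suc-injective e))) (sym (∧-assoc (x == y) (sameWord u v) (a == b)))

  isPalindrome : List Bool → Bool
  isPalindrome m = sameWord m (reverse m)

  isPalindrome-ends : ∀ x m y → isPalindrome (x ∷ (m ∷ʳ y)) ≡ (x == y) ∧ isPalindrome m
  isPalindrome-ends x m y = begin
    sameWord (x ∷ (m ∷ʳ y)) (reverse (x ∷ (m ∷ʳ y)))
      ≡⟨ cong (sameWord (x ∷ (m ∷ʳ y))) (trans (unfold-reverse x (m ∷ʳ y)) (cong (_∷ʳ x) (reverse-++ m (y ∷ [])))) ⟩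
    (x == y) ∧ sameWord (m ∷ʳ y) (reverse m ∷ʳ x)
      ≡⟨ cong ((x == y) ∧_) (sameWord-snoc m (reverse m) y x (sym (length-reverse m))) ⟩
    (x == y) ∧ (isPalindrome m ∧ (y == x))
      ≡⟨ ends x y (isPalindrome m) ⟩
    (x == y) ∧ isPalindrome m ∎
    where
    open ≡-Reasoning
    ends : ∀ x y p → (x == y) ∧ (p ∧ (y == x)) ≡ (x == y) ∧ p
    ends true true p = ∧-comm p true
    ends false false p = ∧-comm p true
    ends true false p = refl
    ends false true p = refl

  -- Doubling by recursion, so that palindromes of length 2k + 1 can be built letter pair by letter pair.
  double : ℕ → ℕ
  double zero = zero
  double (suc k) = suc (suc (double k))

  double≡+ : ∀ k → double k ≡ k + k
  double≡+ zero = refl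
  double≡+ (suc k) = cong suc (trans (cong suc (double≡+ k)) (sym (+-suc k k)))

  double+2≡ : ∀ k → suc (suc (double k)) ≡ suc k * 2
  double+2≡ k = cong (λ z → suc (suc z)) (trans (double≡+ k) (sym (trans (*-comm k 2) (cong (k +_) (+-identityʳ k)))))

  ≤double+2 : ∀ k → k ≤ suc (suc (double k))
  ≤double+2 k = subst (k ≤_) (cong (λ z → suc (suc z)) (sym (double≡+ k))) (≤-trans (m≤m+n k k) (≤-trans (n≤1+n _) (n≤1+n _)))

  count-palindromes : ∀ k Q → count (suc (double k)) (λ m → isPalindrome m ∧ Q m)
    ≡ count k (λ c → Q (c ++ false ∷ reverse c)) + count k (λ c → Q (c ++ true ∷ reverse c))
  count-palindromes zero Q = refl
  count-palindromes (suc k) Q = begin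
    count (suc M) (λ m → R (false ∷ m)) + count (suc M) (λ m → R (true ∷ m))
      ≡⟨ cong₂ _+_ (count-snoc M (λ m → R (false ∷ m))) (count-snoc M (λ m → R (true ∷ m))) ⟩
    (count M (λ m → R (false ∷ (m ∷ʳ false))) + count M (λ m → R (false ∷ (m ∷ʳ true))))
     + (count M (λ m → R (true ∷ (m ∷ʳ false))) + count M (λ m → R (true ∷ (m ∷ʳ true))))
      ≡⟨ cong₂ _+_ (cong₂ _+_ (equalEnds false) (unequalEnds false true refl))
                   (cong₂ _+_ (unequalEnds true false refl) (equalEnds true)) ⟩
    (S false + 0) + (0 + S true)
      ≡⟨ cong (_+ S true) (+-identityʳ (S false)) ⟩
    S false + S true
      ≡⟨ cong₂ _+_ (count-palindromes k (λ m → Q (false ∷ (m ∷ʳ false))))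
                   (count-palindromes k (λ m → Q (true ∷ (m ∷ʳ true)))) ⟩
    (B false false + B true false) + (B false true + B true true)
      ≡⟨ interchange (B false false) (B true false) (B false true) (B true true) ⟩
    (B false false + B false true) + (B true false + B true true)
      ≡⟨ cong₂ _+_ (cong₂ _+_ (reassoc false false) (reassoc false true))
                   (cong₂ _+_ (reassoc true false) (reassoc true true)) ⟩
    count (suc k) (λ c → Q (c ++ false ∷ reverse c)) + count (suc k) (λ c → Q (c ++ true ∷ reverse c)) ∎
    where
    open ≡-Reasoning
    open import Algebra.Properties.CommutativeSemigroup +-commutativeSemigroup using (interchange)
    M : ℕ
    M = suc (double k)
    R : List Bool → Bool
    R m = isPalindrome m ∧ Q m
    S : Bool → ℕ
    S x = count M (λ m → isPalindrome m ∧ Q (x ∷ (m ∷ʳ x)))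
    equalEnds : ∀ x → count M (λ m → R (x ∷ (m ∷ʳ x))) ≡ S x
    equalEnds x = count-ext M (λ m _ → trans (cong (_∧ Q (x ∷ (m ∷ʳ x))) (isPalindrome-ends x m x)) (drop== x))
      where drop== : ∀ x {p q} → ((x == x) ∧ p) ∧ q ≡ p ∧ q
            drop== true = refl
            drop== false = refl
    unequalEnds : ∀ x y → x == y ≡ false → count M (λ m → R (x ∷ (m ∷ʳ y))) ≡ 0
    unequalEnds x y x≠y = trans (count-ext M (λ m _ → cong (_∧ Q (x ∷ (m ∷ʳ y)))
                                   (trans (isPalindrome-ends x m y) (cong (_∧ isPalindrome m) x≠y))))
                                (count-false M)
    B : Bool → Bool → ℕ
    B z x = count k (λ c → Q (x ∷ ((c ++ z ∷ reverse c) ∷ʳ x)))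
    reassoc : ∀ z x → B z x ≡ count k (λ c → Q ((x ∷ c) ++ z ∷ reverse (x ∷ c)))
    reassoc z x = count-ext k (λ c _ → cong (λ w → Q (x ∷ w))
                    (trans (++-assoc c (z ∷ reverse c) (x ∷ []))
                           (cong (λ r → c ++ z ∷ r) (sym (unfold-reverse x c)))))

  weight-palindrome : ∀ x c y → weight (x ∷ (c ++ y ∷ reverse c)) ≡ bit x + (weight c + (bit y + weight c))
  weight-palindrome x c y = cong (bit x +_) (trans (weight-++ c (y ∷ reverse c)) (cong (λ w → weight c + (bit y + w)) (weight-reverse c)))
    where
    weight-reverse : ∀ u → weight (reverse u) ≡ weight u
    weight-reverse [] = refl
    weight-reverse (x ∷ u) = trans (cong weight (unfold-reverse x u))
      (trans (weight-++ (reverse u) (x ∷ []))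
      (trans (cong₂ _+_ (weight-reverse u) (+-identityʳ (bit x))) (+-comm (weight u) (bit x))))

module Cyclic where
  open import Data.Bool using (Bool; true; false; not; _∧_; _∨_)
  open import Data.Nat
  open import Data.Nat.Properties
  open import Data.Nat.DivMod
  open import Data.Nat.Tactic.RingSolver using (solve-∀)
  open import Data.List using (List; []; _∷_; _∷ʳ_; length; upTo)
  open import Data.Bool.ListAction using (all; any)
  open import Data.Product using (Σ; _,_; _×_)
  open import Data.Sum using (inj₁; inj₂)
  open import Data.Empty using (⊥-elim)
  open import Relation.Nullary using (yes; no)
  open import Relation.Binary.PropositionalEquality
  open import Algebra.Properties.CommutativeSemigroup +-commutativeSemigroup using (xy∙z≈xz∙y)
  open Words
  open Lookup

  zerosFromB : (ℕ → Bool) → ℕ → ℕ → Bool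
  zerosFromB f i l = all (λ r → not (f (i + r))) (upTo l)

  blockAtB : ℕ → (ℕ → Bool) → ℕ → ℕ → Bool
  blockAtB n f i l = (1 ≤ᵇ l) ∧ zerosFromB f i l ∧ f (i + (n ∸ 1)) ∧ f (i + l)

  longBlockB : ℕ → ℕ → (ℕ → Bool) → Bool
  longBlockB n t f = any (λ i → any (λ l → (t ≤ᵇ l) ∧ blockAtB n f i l) (upTo n)) (upTo n)

  badB : ℕ → ℕ → (ℕ → Bool) → Bool
  badB n t f = zerosFromB f 0 n ∨ longBlockB n t f

  blockAtB-ext : ∀ n {f g} → (∀ j → f j ≡ g j) → ∀ i l → blockAtB n f i l ≡ blockAtB n g i l
  blockAtB-ext n h i l =
    cong₂ (λ u v → (1 ≤ᵇ l) ∧ u ∧ v) (all-ext (upTo l) (λ r → cong not (h (i + r)))) (cong₂ _∧_ (h _) (h _))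

  badB-ext : ∀ n t {f g} → (∀ j → f j ≡ g j) → badB n t f ≡ badB n t g
  badB-ext n t h = cong₂ _∨_ (all-ext (upTo n) (λ r → cong not (h (0 + r))))
    (any-ext (upTo n) (λ i → any-ext (upTo n) (λ l → cong ((t ≤ᵇ l) ∧_) (blockAtB-ext n h i l))))

  lastOneBefore : ∀ (f : ℕ → Bool) i z → z < i → f z ≡ true →
    Σ ℕ λ a → a < i × f a ≡ true × (∀ j → a < j → j < i → f j ≡ false)
  lastOneBefore f (suc i) z z<i fz with f i in fi
  ... | true = i , ≤-refl , fi , λ j i<j j<i → ⊥-elim (<-irrefl refl (<-≤-trans i<j (≤-pred j<i)))
  ... | false with lastOneBefore f i z (≤∧≢⇒< (≤-pred z<i) (λ { refl → true≢false (trans (sym fz) fi) })) fz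
  ...   | a , a<i , fa , zeros = a , m<n⇒m<1+n a<i , fa , rest
    where rest : ∀ j → a < j → j < suc i → f j ≡ false
          rest j a<j j<i with j <? i
          ... | yes j<i' = zeros j a<j j<i'
          ... | no j≮i = subst (λ x → f x ≡ false) (sym (≤-antisym (≤-pred j<i) (≮⇒≥ j≮i))) fi

  firstOneFrom : ∀ (f : ℕ → Bool) k b → f (b + k) ≡ true →
    Σ ℕ λ c → b ≤ c × f c ≡ true × (∀ j → b ≤ j → j < c → f j ≡ false)
  firstOneFrom f zero b fb = b , ≤-refl , subst (λ x → f x ≡ true) (+-identityʳ b) fb ,
                             λ j b≤j j<b → ⊥-elim (<-irrefl refl (<-≤-trans j<b b≤j))
  firstOneFrom f (suc k) b fbk with f b in fb
  ... | true = b , ≤-refl , fb , λ j b≤j j<b → ⊥-elim (<-irrefl refl (<-≤-trans j<b b≤j))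
  ... | false with firstOneFrom f k (suc b) (subst (λ x → f x ≡ true) (+-suc b k) fbk)
  ...   | c , b<c , fc , zeros = c , ≤-trans (n≤1+n b) b<c , fc , rest
    where rest : ∀ j → b ≤ j → j < c → f j ≡ false
          rest j b≤j j<c with b ≟ j
          ... | yes refl = fb
          ... | no b≢j = zeros j (≤∧≢⇒< b≤j b≢j) j<c

  module Period (n' : ℕ) where

    N : ℕ
    N = suc n'

    Periodic : (ℕ → Bool) → Set
    Periodic f = ∀ i j → i % N ≡ j % N → f i ≡ f j

    %-+ʳ : ∀ a b c → a % N ≡ b % N → (a + c) % N ≡ (b + c) % N
    %-+ʳ a b c e = trans (%-distribˡ-+ a c N) (trans (cong (λ z → (z + c % N) % N) e) (sym (%-distribˡ-+ b c N)))

    periodic-+N : ∀ {f} → Periodic f → ∀ x → f (x + N) ≡ f x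
    periodic-+N per x = per (x + N) x ([m+n]%n≡m%n x N)

    ZeroWindow : ℕ → (ℕ → Bool) → Set
    ZeroWindow t f = Σ ℕ λ i → ∀ r → r < t → f (i + r) ≡ false

    bad⇒window : ∀ t f → t ≤ N → badB N t f ≡ true → ZeroWindow t f
    bad⇒window t f t≤N e with ∨-true {zerosFromB f 0 N} e
    ... | inj₁ z = 0 , λ r r<t → not-true (all-true N (λ x → x) (λ r → not (f (0 + r))) z r (<-≤-trans r<t t≤N))
    ... | inj₂ a with any-true N (λ x → x) _ a
    ...   | i , _ , ai with any-true N (λ x → x) _ ai
    ...     | l , _ , al = i , λ r r<t →
                 let (t≤l , blk) = ∧-true {t ≤ᵇ l} al
                     (_ , blk′) = ∧-true {1 ≤ᵇ l} blk
                     (zeros , _) = ∧-true {zerosFromB f i l} blk′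
                 in not-true (all-true l (λ x → x) (λ r → not (f (i + r))) zeros r (<-≤-trans r<t (≤ᵇ⇒≤ t l (true⇒T t≤l))))

    runShorterThanPeriod : ∀ {f} → Periodic f → ∀ {z s l} → f z ≡ true → (∀ r → r < l → f (s + r) ≡ false) → l < N
    runShorterThanPeriod {f} per {z} {s} {l} fz run with N ≤? l
    ... | no N≰l = ≰⇒> N≰l
    ... | yes N≤l = true≢false (trans (sym fz) (trans (per z (s + r) (sym hits)) (run r (<-≤-trans (m%n<n X N) N≤l))))
      where
      X : ℕ
      X = z + n' * s
      r : ℕ
      r = X % N
      hits : (s + r) % N ≡ z % N
      hits = begin
        (s + X % N) % N ≡⟨ %-distribˡ-+ s (X % N) N ⟩
        (s % N + X % N % N) % N ≡⟨ cong (λ w → (s % N + w) % N) (m%n%n≡m%n X N) ⟩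
        (s % N + X % N) % N ≡⟨ %-distribˡ-+ s X N ⟨
        (s + X) % N ≡⟨ cong (_% N) (shuffle s z n') ⟩
        (z + s * N) % N ≡⟨ [m+kn]%n≡m%n z s N ⟩
        z % N ∎
        where open ≡-Reasoning
              shuffle : ∀ s z n' → s + (z + n' * s) ≡ z + s * suc n'
              shuffle = solve-∀

    blockOfRun : ∀ {f} → Periodic f → ∀ {a l} → 1 ≤ l → f a ≡ true → (∀ r → r < l → f (suc a + r) ≡ false) →
                 f (suc a + l) ≡ true → blockAtB N f (suc a) l ≡ true
    blockOfRun {f} per {a} {l} (s≤s _) fa run fc = cong₂ _∧_ zerosOk (cong₂ _∧_ oneBefore fc)
      where
      zerosOk : zerosFromB f (suc a) l ≡ true
      zerosOk = true-all l (λ x → x) (λ r → not (f (suc a + r))) (λ r lt → false⇒not (run r lt))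
      oneBefore : f (suc a + n') ≡ true
      oneBefore = trans (cong f (sym (+-suc a n'))) (trans (periodic-+N per a) fa)

    oneAfter : ∀ {f} → Periodic f → ∀ {z} → f z ≡ true → ∀ b → f (b + (z + b * n')) ≡ true
    oneAfter per {z} fz b = trans (per _ z (trans (cong (_% N) (shuffle b z n')) ([m+kn]%n≡m%n z b N))) fz
      where shuffle : ∀ b z n' → b + (z + b * n') ≡ z + b * suc n'
            shuffle = solve-∀

    enclosingRun : ∀ {f} → Periodic f → ∀ {z i t} → f z ≡ true → z < i → (∀ r → r < t → f (i + r) ≡ false) →
      Σ ℕ λ a → Σ ℕ λ c → a < i × i + t ≤ c × f a ≡ true × f c ≡ true × (∀ j → a < j → j < c → f j ≡ false)
    enclosingRun {f} per {z} {i} {t} fz z<i window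
      with lastOneBefore f i z z<i fz | firstOneFrom f (z + (i + t) * n') (i + t) (oneAfter per fz (i + t))
    ... | a , a<i , fa , left | c , i+t≤c , fc , right = a , c , a<i , i+t≤c , fa , fc , zeros
      where
      zeros : ∀ j → a < j → j < c → f j ≡ false
      zeros j a<j j<c with j <? i
      ... | yes j<i = left j a<j j<i
      ... | no j≮i with m≤n⇒∃[o]m+o≡n (≮⇒≥ j≮i)
      ...   | g , refl with g <? t
      ...     | yes g<t = window g g<t
      ...     | no g≮t = right (i + g) (+-monoʳ-≤ i (≮⇒≥ g≮t)) j<c

    blockAtB-start : ∀ {f} → Periodic f → ∀ a b l → a % N ≡ b % N → blockAtB N f a l ≡ blockAtB N f b l
    blockAtB-start per a b l e = blockAtB-ext N (λ j → per (a + j) (b + j) (%-+ʳ a b j e)) 0 l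

    longBlock : ∀ {f} → Periodic f → ∀ {t s l} → t ≤ l → l < N → blockAtB N f s l ≡ true → longBlockB N t f ≡ true
    longBlock per {t} {s} {l} t≤l l<N blk =
      true-any N (λ x → x) _ (s % N) (m%n<n s N)
        (true-any N (λ x → x) _ l l<N (cong₂ _∧_ (T⇒true (≤⇒≤ᵇ t≤l)) (trans (blockAtB-start per (s % N) s l (m%n%n≡m%n s N)) blk)))

    someOne : ∀ f → zerosFromB f 0 N ≡ false → Σ ℕ λ z → z < N × f z ≡ true
    someOne f allZero with all-false N (λ x → x) (λ r → not (f (0 + r))) allZero
    ... | z , z<N , fz = z , z<N , not-false fz

    window-+N : ∀ {f} → Periodic f → ∀ {i t} → (∀ r → r < t → f (i + r) ≡ false) → ∀ r → r < t → f (i + N + r) ≡ false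
    window-+N {f} per {i} w r lt = trans (cong f (xy∙z≈xz∙y i N r)) (trans (periodic-+N per (i + r)) (w r lt))

    -- Conversely, a window of t ≥ 1 zeros makes the sequence bad: either it is all-zero, or
    -- the maximal run of zeros containing the window is a block of length between t and N.
    window⇒bad : ∀ t f → Periodic f → 1 ≤ t → ZeroWindow t f → badB N t f ≡ true
    window⇒bad t f per 1≤t (i , w) with zerosFromB f 0 N in allZero
    ... | true = refl
    ... | false with someOne f allZero
    ...   | z , z<N , fz with enclosingRun per fz (<-≤-trans z<N (m≤n+m N i)) (window-+N per w)
    ...     | a , c , a<i′ , i′+t≤c , fa , fc , zeros =
                longBlock per t≤l (runShorterThanPeriod per fz run) (blockOfRun per (≤-trans 1≤t t≤l) fa run fc′)
      where
      i′ : ℕ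
      i′ = i + N
      l : ℕ
      l = c ∸ suc a
      ends : suc a + l ≡ c
      ends = m+[n∸m]≡n (<-≤-trans a<i′ (≤-trans (m≤m+n i′ t) i′+t≤c))
      run : ∀ r → r < l → f (suc a + r) ≡ false
      run r lt = zeros (suc a + r) (s≤s (m≤m+n a r)) (subst (suc a + r <_) ends (+-monoʳ-< (suc a) lt))
      fc′ : f (suc a + l) ≡ true
      fc′ = subst (λ x → f x ≡ true) (sym ends) fc
      t≤l : t ≤ l
      t≤l = ≤-trans (≤-reflexive (sym (m+n∸m≡n i′ t))) (≤-trans (∸-monoˡ-≤ i′ i′+t≤c) (∸-monoʳ-≤ c a<i′))

    -- Badness is invariant under cyclic shifts, since zero windows are.
    bad-shift : ∀ t f p → Periodic f → 1 ≤ t → t ≤ N → badB N t (λ j → f (j + p)) ≡ badB N t f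
    bad-shift t f p per 1≤t t≤N = bool-ext
      (λ e → window⇒bad t f per 1≤t (unshift (bad⇒window t (λ j → f (j + p)) t≤N e)))
      (λ e → window⇒bad t (λ j → f (j + p)) shifted 1≤t (shift (bad⇒window t f t≤N e)))
      where
      shifted : Periodic (λ j → f (j + p))
      shifted i j e = per (i + p) (j + p) (%-+ʳ i j p e)
      unshift : ZeroWindow t (λ j → f (j + p)) → ZeroWindow t f
      unshift (i , w) = i + p , λ r lt → trans (cong f (xy∙z≈xz∙y i p r)) (w r lt)
      shift : ZeroWindow t f → ZeroWindow t (λ j → f (j + p))
      shift (i , w) = i + n' * p , λ r lt →
        trans (per _ _ (trans (cong (_% N) (shuffle i n' p r)) ([m+kn]%n≡m%n (i + r) p N))) (w r lt)
        where shuffle : ∀ i n' p r → i + n' * p + r + p ≡ i + r + p * suc n'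
              shuffle = solve-∀

    cyclic : List Bool → ℕ → Bool
    cyclic l j = get l (j % N)

    cyclic-periodic : ∀ l → Periodic (cyclic l)
    cyclic-periodic l i j e = cong (get l) e

    cyclic-rotate : ∀ l → length l ≡ N → ∀ j → cyclic (rotate l) j ≡ cyclic l (suc j)
    cyclic-rotate (x ∷ xs) e j with suc (j % N) <? N
    ... | yes lt = sym (trans (cong (get (x ∷ xs)) (trans suc-% (m<n⇒m%n≡m lt)))
                    (sym (get-++ˡ xs (x ∷ []) (j % N) (subst (j % N <_) (sym (suc-injective e)) (≤-pred lt)))))
      where suc-% : suc j % N ≡ suc (j % N) % N
            suc-% = trans (cong (λ z → suc z % N) (m≡m%n+[m/n]*n j N)) ([m+kn]%n≡m%n (suc (j % N)) (j / N) N)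
    ... | no nlt = trans (cong (get (xs ∷ʳ x)) (trans last (trans (sym (suc-injective e)) (sym (+-identityʳ (length xs))))))
                   (trans (get-++ʳ xs (x ∷ []) 0) (cong (get (x ∷ xs)) (sym wraps)))
      where
      last : j % N ≡ n'
      last = ≤-antisym (≤-pred (m%n<n j N)) (≤-pred (≮⇒≥ nlt))
      wraps : suc j % N ≡ 0
      wraps = trans (cong (λ z → suc z % N) (m≡m%n+[m/n]*n j N))
                    (trans ([m+kn]%n≡m%n (suc (j % N)) (j / N) N) (trans (cong (λ z → suc z % N) last) (n%n≡0 N)))

    cyclic-rotateBy : ∀ p l → length l ≡ N → ∀ j → cyclic (rotateBy p l) j ≡ cyclic l (j + p)
    cyclic-rotateBy zero l e j = cong (cyclic l) (sym (+-identityʳ j))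
    cyclic-rotateBy (suc p) l e j =
      trans (cyclic-rotateBy p (rotate l) (trans (length-rotate l) e) j)
            (trans (cyclic-rotate l e (j + p)) (cong (cyclic l) (sym (+-suc j p))))

    bad-rotateBy : ∀ t p l → length l ≡ N → 1 ≤ t → t ≤ N → badB N t (cyclic (rotateBy p l)) ≡ badB N t (cyclic l)
    bad-rotateBy t p l e 1≤t t≤N =
      trans (badB-ext N t (cyclic-rotateBy p l e)) (bad-shift t (cyclic l) p (cyclic-periodic l) 1≤t t≤N)

    cyclic-inRange : ∀ l y → y < N → cyclic l y ≡ get l y
    cyclic-inRange l y lt = cong (get l) (m<n⇒m%n≡m lt)

module ReflectionSymmetry where

  open import Data.Bool using (Bool; true; false; _∧_)
  open import Data.Bool.Properties using (∧-comm)
  open import Data.Nat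
  open import Data.Nat.Properties
  open import Data.Nat.DivMod
  open import Data.Nat.Tactic.RingSolver using (solve-∀)
  open import Data.List using (List; _∷_; _++_; length; reverse; upTo)
  open import Data.List.Properties using (length-reverse)
  open import Data.Bool.ListAction using (all)
  open import Data.Product using (_,_)
  open import Relation.Binary.PropositionalEquality
  open Words
  open Palindromes
  open Lookup
  open Cyclic

  module Reflections (n' : ℕ) where
    open Period n'

    -- The Boolean test "f (q − i) = f i for all i < N", with q − i computed as q + (N − i).
    reflFixedB : ℕ → (ℕ → Bool) → Bool
    reflFixedB q f = all (λ i → f (q + (N ∸ i)) == f i) (upTo N)

    Symmetric : ℕ → (ℕ → Bool) → Set
    Symmetric q f = ∀ i j → (i + j) % N ≡ q % N → f i ≡ f j

    reflFixed⇒symmetric : ∀ q f → Periodic f → reflFixedB q f ≡ true → Symmetric q f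
    reflFixed⇒symmetric q f per e i j h =
      trans (per i i₀ (sym (m%n%n≡m%n i N)))
            (trans (sym (==⇒≡ (all-true N (λ x → x) (λ i → f (q + (N ∸ i)) == f i) e i₀ (m%n<n i N))))
                   (per _ _ (sym partner)))
      where
      i₀ : ℕ
      i₀ = i % N
      k : ℕ
      k = i / N
      -- i + (N − i₀) is a multiple of N, so j ≡ q − i₀ modulo N.
      wrap : i + (N ∸ i₀) ≡ N + k * N
      wrap = begin
        i + (N ∸ i₀) ≡⟨ cong (_+ (N ∸ i₀)) (m≡m%n+[m/n]*n i N) ⟩
        i₀ + k * N + (N ∸ i₀) ≡⟨ shuffle i₀ (k * N) (N ∸ i₀) ⟩
        (i₀ + (N ∸ i₀)) + k * N ≡⟨ cong (_+ k * N) (m+[n∸m]≡n (<⇒≤ (m%n<n i N))) ⟩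
        N + k * N ∎
        where open ≡-Reasoning
              shuffle : ∀ a b c → a + b + c ≡ a + c + b
              shuffle = solve-∀
      partner : j % N ≡ (q + (N ∸ i₀)) % N
      partner = begin
        j % N ≡⟨ [m+kn]%n≡m%n j (suc k) N ⟨
        (j + (N + k * N)) % N ≡⟨ cong (λ z → (j + z) % N) (sym wrap) ⟩
        (j + (i + (N ∸ i₀))) % N ≡⟨ cong (_% N) (shuffle j i (N ∸ i₀)) ⟩
        ((i + j) + (N ∸ i₀)) % N ≡⟨ %-+ʳ (i + j) q (N ∸ i₀) h ⟩
        (q + (N ∸ i₀)) % N ∎
        where open ≡-Reasoning
              shuffle : ∀ a b c → a + (b + c) ≡ b + a + c
              shuffle = solve-∀

    symmetric⇒reflFixed : ∀ q f → Symmetric q f → reflFixedB q f ≡ true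
    symmetric⇒reflFixed q f s = true-all N (λ x → x) _ (λ i lt → ≡⇒== (s _ _ (opposite i lt)))
      where opposite : ∀ i → i < N → (q + (N ∸ i) + i) % N ≡ q % N
            opposite i lt = trans (cong (_% N) (trans (+-assoc q (N ∸ i) i) (cong (q +_) (m∸n+n≡m (<⇒≤ lt)))))
                                  ([m+n]%n≡m%n q N)

    -- Shifting by (N − 1)·p = −p conjugates the reflection i ↦ 2p − i into i ↦ −i.
    symmetric-shift : ∀ q p f → q ≡ p + p → Periodic f → Symmetric q (λ j → f (j + n' * p)) → Symmetric 0 f
    symmetric-shift q p f refl per s i j h = trans (sym (unshift i)) (trans (s (i + p) (j + p) sum) (unshift j))
      where
      unshift : ∀ x → f (x + p + n' * p) ≡ f x
      unshift x = per _ _ (trans (cong (_% N) (shuffle x p n')) ([m+kn]%n≡m%n x p N))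
        where shuffle : ∀ x p n' → x + p + n' * p ≡ x + p * suc n'
              shuffle = solve-∀
      sum : (i + p + (j + p)) % N ≡ (p + p) % N
      sum = trans (cong (_% N) (shuffle i j p)) (%-+ʳ (i + j) 0 (p + p) h)
        where shuffle : ∀ a b c → a + c + (b + c) ≡ (a + b) + (c + c)
              shuffle = solve-∀

    symmetric-unshift : ∀ q p f → q ≡ p + p → Periodic f → Symmetric 0 f → Symmetric q (λ j → f (j + n' * p))
    symmetric-unshift q p f refl per s i j h = s _ _ (begin
        (i + n' * p + (j + n' * p)) % N ≡⟨ cong (_% N) (shuffle i j (n' * p)) ⟩
        ((i + j) + (n' * p + n' * p)) % N ≡⟨ %-+ʳ (i + j) (p + p) _ h ⟩
        (p + p + (n' * p + n' * p)) % N ≡⟨ cong (_% N) (multiple p n') ⟩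
        (0 + (p + p) * N) % N ≡⟨ [m+kn]%n≡m%n 0 (p + p) N ⟩
        0 % N ∎)
      where open ≡-Reasoning
            shuffle : ∀ a b c → a + c + (b + c) ≡ (a + b) + (c + c)
            shuffle = solve-∀
            multiple : ∀ p n' → p + p + (n' * p + n' * p) ≡ 0 + (p + p) * suc n'
            multiple = solve-∀

    reflFixed0⇔palindrome : ∀ x m → length m ≡ n' → reflFixedB 0 (cyclic (x ∷ m)) ≡ isPalindrome m
    reflFixed0⇔palindrome x m lm = bool-ext to from
      where
      f : ℕ → Bool
      f = cyclic (x ∷ m)
      inRange : ∀ y → y < N → f y ≡ get (x ∷ m) y
      inRange y lt = cong (get (x ∷ m)) (m<n⇒m%n≡m lt)
      mirror : ∀ j → j < n' → f (N ∸ suc j) ≡ get m (n' ∸ suc j)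
      mirror j lt = trans (inRange (n' ∸ j) (s≤s (m∸n≤m n' j))) (cong (get (x ∷ m)) (∸-suc n' j lt))
      direct : ∀ j → j < n' → f (suc j) ≡ get m j
      direct j lt = inRange (suc j) (s≤s lt)
      reversed : ∀ j → j < n' → get (reverse m) j ≡ get m (n' ∸ suc j)
      reversed j lt = trans (get-reverse m j (subst (j <_) (sym lm) lt)) (cong (λ z → get m (z ∸ suc j)) lm)
      to : reflFixedB 0 f ≡ true → isPalindrome m ≡ true
      to e = ≡⇒sameWord (get-ext m (reverse m) (sym (length-reverse m)) λ j lt →
        let j<n' = subst (j <_) lm lt
            pair = ==⇒≡ (all-true N (λ z → z) (λ i → f (0 + (N ∸ i)) == f i) e (suc j) (s≤s j<n'))
        in trans (sym (direct j j<n')) (trans (sym pair) (trans (mirror j j<n') (sym (reversed j j<n')))))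
      from : isPalindrome m ≡ true → reflFixedB 0 f ≡ true
      from e = true-all N (λ z → z) (λ i → f (0 + (N ∸ i)) == f i) pair
        where
        pal : m ≡ reverse m
        pal = sameWord⇒≡ e
        pair : ∀ i → i < N → f (0 + (N ∸ i)) == f i ≡ true
        pair zero _ = ≡⇒== (trans (cong (get (x ∷ m)) (n%n≡0 N)) (sym (inRange 0 z<s)))
        pair (suc j) (s≤s lt) = ≡⇒== (trans (mirror j lt) (trans (sym mid) (sym (direct j lt))))
          where mid : get m j ≡ get m (n' ∸ suc j)
                mid = trans (cong (λ z → get z j) pal) (reversed j lt)

    reflFixedB-ext : ∀ q {f g} → (∀ j → f j ≡ g j) → reflFixedB q f ≡ reflFixedB q g
    reflFixedB-ext q h = all-ext (upTo N) (λ i → cong₂ _==_ (h _) (h i))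

  -- Counting words of length 2k+2 fixed by the reflection i ↦ 2p − i, under a rotation-invariant
  -- property Q: rotating by −p reduces to the reflection i ↦ −i, whose fixed words are
  -- x c y (reverse c) with letters x, y and a word c of length k.
  count-reflectionFixed : ∀ k q p (Q : List Bool → Bool) → q ≡ p + p →
    (∀ l → length l ≡ suc (suc (double k)) → Q (rotateBy (suc (double k) * p) l) ≡ Q l) →
    count (suc (suc (double k))) (λ l → Q l ∧ Reflections.reflFixedB (suc (double k)) q (Period.cyclic (suc (double k)) l))
    ≡ (count k (λ c → Q (false ∷ (c ++ false ∷ reverse c))) + count k (λ c → Q (false ∷ (c ++ true ∷ reverse c))))
      + (count k (λ c → Q (true ∷ (c ++ false ∷ reverse c))) + count k (λ c → Q (true ∷ (c ++ true ∷ reverse c))))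
  count-reflectionFixed k q p Q q≡2p Q-rot = begin
    count N (λ l → Q l ∧ reflFixedB q (cyclic l))
      ≡⟨ count-rotateBy p′ N (λ l → Q l ∧ reflFixedB q (cyclic l)) ⟨
    count N (λ l → Q (rotateBy p′ l) ∧ reflFixedB q (cyclic (rotateBy p′ l)))
      ≡⟨ count-ext N (λ l e → cong₂ _∧_ (Q-rot l e) (rotated l e)) ⟩
    count N (λ l → Q l ∧ reflFixedB 0 (cyclic l))
      ≡⟨ cong₂ _+_ (firstLetter false) (firstLetter true) ⟩
    _ ∎
    where
    open ≡-Reasoning
    n′ : ℕ
    n′ = suc (double k)
    open Period n′
    open Reflections n′
    p′ : ℕ
    p′ = n′ * p
    rotated : ∀ l → length l ≡ N → reflFixedB q (cyclic (rotateBy p′ l)) ≡ reflFixedB 0 (cyclic l)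
    rotated l e = trans (reflFixedB-ext q (cyclic-rotateBy p′ l e)) (bool-ext
      (λ h → symmetric⇒reflFixed 0 (cyclic l) (symmetric-shift q p (cyclic l) q≡2p (cyclic-periodic l)
               (reflFixed⇒symmetric q _ (λ i j e → cyclic-periodic l (i + p′) (j + p′) (%-+ʳ i j p′ e)) h)))
      (λ h → symmetric⇒reflFixed q _ (symmetric-unshift q p (cyclic l) q≡2p (cyclic-periodic l)
               (reflFixed⇒symmetric 0 (cyclic l) (cyclic-periodic l) h))))
    firstLetter : ∀ x → count n′ (λ m → Q (x ∷ m) ∧ reflFixedB 0 (cyclic (x ∷ m)))
      ≡ count k (λ c → Q (x ∷ (c ++ false ∷ reverse c))) + count k (λ c → Q (x ∷ (c ++ true ∷ reverse c)))
    firstLetter x = trans (count-ext n′ (λ m e → trans (cong (Q (x ∷ m) ∧_) (reflFixed0⇔palindrome x m e))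
                                                        (∧-comm (Q (x ∷ m)) (isPalindrome m))))
                          (count-palindromes k (λ m → Q (x ∷ m)))

module PalindromeBadness where

  open import Data.Bool using (Bool; true; false; not; _∧_; _∨_)
  open import Data.Nat
  open import Data.Nat.Properties
  open import Data.Nat.DivMod
  open import Data.Nat.Tactic.RingSolver using (solve-∀)
  open import Data.List using (List; _∷_; _++_; length; reverse; take; drop)
  open import Data.Product using (Σ; _,_; proj₁; proj₂)
  open import Data.Sum using (inj₁; inj₂)
  open import Relation.Nullary using (yes; no; ¬_)
  open import Data.Bool.Properties using (∨-zeroʳ)
  open import Relation.Binary using (tri<; tri≈; tri>)
  open import Relation.Binary.PropositionalEquality
  open Words
  open Palindromes
  open Lookup
  open Cyclic

  lt-witness : ∀ {a b} → a < b → Σ ℕ λ g → suc a + g ≡ b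
  lt-witness lt = m≤n⇒∃[o]m+o≡n lt

  le-by : ∀ a b g → a + g ≡ b → a ≤ b
  le-by a b g e = subst (a ≤_) e (m≤m+n a g)

  half<whole : ∀ s d → 1 ≤ s + (s + d) → s < s + (s + d)
  half<whole zero d h = h
  half<whole (suc s) d _ = s≤s (subst (suc s ≤_) (sym (+-suc s (s + d))) (s≤s (m≤m+n s (s + d))))

  below-half : ∀ s d u g → d ≤ 1 → suc (suc u) + g ≡ s + d → u < s
  below-half s zero u g _ eq = le-by (suc u) s (suc g) (trans (+-suc (suc u) g) (trans eq (+-identityʳ s)))
  below-half s (suc zero) u g _ eq = le-by (suc u) s g (+-cancelʳ-≡ 1 (suc u + g) s (trans (+-comm (suc u + g) 1) eq))
  below-half s (suc (suc d)) u g (s≤s ()) eq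

  -- Write k = 2s + d with d ≤ 1 and e = s + d (so s = ⌊k/2⌋ and e = ⌈k/2⌉). A palindromic word
  -- x c y (reverse c) of length 2k+2 has k cyclically consecutive zeros iff c = 0, or x = 0 and
  -- the first s letters of c vanish, or y = 0 and the letters of c from index e on vanish.
  module LongRun (s d : ℕ) where

    k e : ℕ
    k = s + (s + d)
    e = s + d

    prefixZero suffixZero : List Bool → Bool
    prefixZero c = allFalse (take s c)
    suffixZero c = allFalse (drop e c)

    longRun : Bool → List Bool → Bool → Bool
    longRun x c y = allFalse c ∨ (not x ∧ prefixZero c) ∨ (not y ∧ suffixZero c)

  module PalindromeWindows (s d : ℕ) (d≤1 : d ≤ 1) (k≥1 : 1 ≤ s + (s + d))
                           (x : Bool) (c : List Bool) (y : Bool) (lc : length c ≡ s + (s + d)) where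
    open LongRun s d
    n' : ℕ
    n' = suc (double k)
    open Period n'
    L : List Bool
    L = x ∷ (c ++ y ∷ reverse c)
    f : ℕ → Bool
    f = cyclic L

    N≡ : N ≡ suc (suc (k + k))
    N≡ = cong (λ z → suc (suc z)) (double≡+ k)

    s<k : s < k
    s<k = half<whole s d k≥1

    at0 : f 0 ≡ x
    at0 = cyclic-inRange L 0 z<s

    atC : ∀ j → j < k → f (suc j) ≡ get c j
    atC j lt = trans (cyclic-inRange L (suc j) (subst (suc j <_) (sym N≡) (s≤s (≤-trans lt (≤-trans (m≤m+n k k) (n≤1+n (k + k)))))))
                     (get-++ˡ c (y ∷ reverse c) j (subst (j <_) (sym lc) lt))

    atY : f (suc k) ≡ y
    atY = trans (cyclic-inRange L (suc k) (subst (suc k <_) (sym N≡) (s≤s (s≤s (m≤m+n k k)))))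
                (trans (cong (get (c ++ y ∷ reverse c)) (trans (sym (+-identityʳ k)) (cong (_+ 0) (sym lc))))
                       (get-++ʳ c (y ∷ reverse c) 0))

    atMirror : ∀ j v → suc j + v ≡ k → f (suc (suc (k + v))) ≡ get c j
    atMirror j v jv = trans (cyclic-inRange L (suc (suc (k + v))) (subst (suc (suc (k + v)) <_) (sym N≡) (s≤s (s≤s (+-monoʳ-< k v<k)))))
                      (trans (cong (get (c ++ y ∷ reverse c)) (trans (sym (+-suc k v)) (cong (_+ suc v) (sym lc))))
                      (trans (get-++ʳ c (y ∷ reverse c) (suc v))
                      (trans (get-reverse c v (subst (v <_) (sym lc) v<k))
                             (cong (get c) (trans (cong (_∸ suc v) lc) index)))))
      where
      v<k : v < k
      v<k = le-by (suc v) k j (trans (cong suc (+-comm v j)) jv)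
      index : k ∸ suc v ≡ j
      index = trans (cong (_∸ suc v) (sym jv)) (trans (cong (_∸ suc v) (sym (+-suc j v))) (m+n∸n≡m j (suc v)))

    atN : ∀ j → f (N + j) ≡ f j
    atN j = cyclic-periodic L (N + j) j (trans (cong (_% N) (+-comm N j)) ([m+n]%n≡m%n j N))

    e+r<k : ∀ r → r < s → e + r < k
    e+r<k r lt with lt-witness lt
    ... | g , hs = le-by (suc (e + r)) k g (trans (shuffle e r g) (trans (cong (e +_) hs) (+-comm e s)))
      where shuffle : ∀ e r g → suc (e + r) + g ≡ e + (suc r + g)
            shuffle = solve-∀

    beyondHalf : ∀ u → suc s + u < k → u < s
    beyondHalf u lt with lt-witness lt
    ... | g , hg = below-half s d u g d≤1 (+-cancelˡ-≡ s _ _ (trans (shuffle s u g) hg))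
      where shuffle : ∀ s u g → s + (suc (suc u) + g) ≡ suc (suc s + u) + g
            shuffle = solve-∀

    windowInC : allFalse c ≡ true → ZeroWindow k f
    windowInC z = 1 , λ r lt → trans (atC r lt) (allFalse⇒get c z r)

    windowThroughX : x ≡ false → prefixZero c ≡ true → ZeroWindow k f
    windowThroughX x0 pz = suc (suc (k + e)) , zeros
      where
      low : ∀ j → j < s → get c j ≡ false
      low = allFalse-take⇒ s c pz
      zeros : ∀ r → r < k → f (suc (suc (k + e)) + r) ≡ false
      zeros r lt with <-cmp r s
      ... | tri< r<s _ _ with lt-witness r<s
      ...   | g , hs = trans (cong f (cong (λ z → suc (suc z)) (+-assoc k e r)))
                             (trans (atMirror g (e + r) mirrored) (low g (le-by (suc g) s r (trans (cong suc (+-comm g r)) hs))))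
        where mirrored : suc g + (e + r) ≡ k
              mirrored = trans (shuffle g e r) (trans (cong (e +_) hs) (+-comm e s))
                where shuffle : ∀ g e r → suc g + (e + r) ≡ e + (suc r + g)
                      shuffle = solve-∀
      zeros r lt | tri≈ _ refl _ = trans (cong f (trans (wrap s d) (cong (_+ 0) (sym N≡)))) (trans (atN 0) (trans at0 x0))
        where wrap : ∀ s d → suc (suc (s + (s + d) + (s + d))) + s ≡ suc (suc (s + (s + d) + (s + (s + d)))) + 0
              wrap = solve-∀
      zeros r lt | tri> _ _ s<r with lt-witness s<r
      ... | u , refl = trans (cong f (trans (wrap s d u) (cong (_+ suc u) (sym N≡))))
                             (trans (atN (suc u)) (trans (atC u (<-trans u<s s<k)) (low u u<s)))
        where
        wrap : ∀ s d u → suc (suc (s + (s + d) + (s + d))) + (suc s + u) ≡ suc (suc (s + (s + d) + (s + (s + d)))) + suc u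
        wrap = solve-∀
        u<s : u < s
        u<s = beyondHalf u lt

    windowThroughY : y ≡ false → suffixZero c ≡ true → ZeroWindow k f
    windowThroughY y0 sz = suc e , zeros
      where
      high : ∀ j → e ≤ j → get c j ≡ false
      high = allFalse-drop⇒ e c sz
      zeros : ∀ r → r < k → f (suc e + r) ≡ false
      zeros r lt with <-cmp r s
      ... | tri< r<s _ _ = trans (atC (e + r) (e+r<k r r<s)) (high (e + r) (m≤m+n e r))
      ... | tri≈ _ refl _ = trans (cong f (cong suc (+-comm e s))) (trans atY y0)
      ... | tri> _ _ s<r with lt-witness s<r
      ...   | u , refl with lt-witness (beyondHalf u lt)
      ...     | g , hg = trans (cong f (wrap s d u)) (trans (atMirror (g + e) u mirrored) (high (g + e) (m≤n+m e g)))
        where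
        wrap : ∀ s d u → suc (s + d) + (suc s + u) ≡ suc (suc (s + (s + d) + u))
        wrap = solve-∀
        mirrored : suc (g + e) + u ≡ k
        mirrored = trans (shuffle g e u) (trans (cong (_+ e) hg) refl)
          where shuffle : ∀ g e u → suc (g + e) + u ≡ suc u + g + e
                shuffle = solve-∀

    criterion⇒window : longRun x c y ≡ true → ZeroWindow k f
    criterion⇒window h with ∨-true {allFalse c} h
    ... | inj₁ z = windowInC z
    ... | inj₂ h′ with ∨-true {not x ∧ prefixZero c} h′
    ...   | inj₁ hx = windowThroughX (not-true (proj₁ (∧-true {not x} hx))) (proj₂ (∧-true {not x} hx))
    ...   | inj₂ hy = windowThroughY (not-true (proj₁ (∧-true {not y} hy))) (proj₂ (∧-true {not y} hy))

    byC : allFalse c ≡ true → longRun x c y ≡ true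
    byC h rewrite h = refl

    byX : x ≡ false → prefixZero c ≡ true → longRun x c y ≡ true
    byX refl h rewrite h = ∨-zeroʳ (allFalse c)

    byY : y ≡ false → suffixZero c ≡ true → longRun x c y ≡ true
    byY refl h rewrite h = trans (cong (allFalse c ∨_) (∨-zeroʳ (not x ∧ prefixZero c))) (∨-zeroʳ (allFalse c))

    inWindow : ∀ {i₀} → (∀ r → r < k → f (i₀ + r) ≡ false) → ∀ P → i₀ ≤ P → P < i₀ + k → f P ≡ false
    inWindow {i₀} w P le lt with m≤n⇒∃[o]m+o≡n le
    ... | g , refl = w g (+-cancelˡ-< i₀ g k lt)

    beyondC : ∀ j → ¬ (j < k) → get c j ≡ false
    beyondC j j≮k = get-beyond c j (subst (_≤ j) (sym lc) (≮⇒≥ j≮k))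

    mirrorBelow : ∀ j v → e ≤ j → suc j + v ≡ k → v < s
    mirrorBelow j v e≤j jv with m≤n⇒∃[o]m+o≡n e≤j
    ... | g , refl = le-by (suc v) s g (+-cancelˡ-≡ e _ _ (trans (shuffle e g v) (trans jv (+-comm s e))))
      where shuffle : ∀ e g v → e + (suc v + g) ≡ suc (e + g) + v
            shuffle = solve-∀

    mirrorAbove : ∀ j v → j < s → suc j + v ≡ k → e ≤ v
    mirrorAbove j v j<s jv with lt-witness j<s
    ... | g , hs = le-by e v g (+-cancelˡ-≡ (suc j) _ _ (trans (shuffle j e g) (trans (cong (_+ e) hs) (sym jv))))
      where shuffle : ∀ j e g → suc j + (e + g) ≡ suc j + g + e
            shuffle = solve-∀

    fromWindowAt0 : (∀ r → r < k → f r ≡ false) → longRun x c y ≡ true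
    fromWindowAt0 w = byX (trans (sym at0) (inWindow w 0 z≤n k≥1)) (allFalse-take⇐ s c low)
      where low : ∀ j → j < s → get c j ≡ false
            low j j<s = trans (sym (atC j (<-trans j<s s<k))) (inWindow w (suc j) z≤n (≤-<-trans j<s s<k))

    fromWindowAt1 : (∀ r → r < k → f (suc r) ≡ false) → longRun x c y ≡ true
    fromWindowAt1 w = byC (get⇒allFalse c letter)
      where letter : ∀ j → get c j ≡ false
            letter j with j <? k
            ... | yes lt = trans (sym (atC j lt)) (inWindow w (suc j) (s≤s z≤n) (s≤s lt))
            ... | no j≮k = beyondC j j≮k

    fromWindowThroughY : ∀ a → a < k → (∀ r → r < k → f (suc (suc a) + r) ≡ false) → longRun x c y ≡ true
    fromWindowThroughY a a<k w = byY y0 (allFalse-drop⇐ e c high)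
      where
      y0 : y ≡ false
      y0 = trans (sym atY) (inWindow w (suc k) (s≤s a<k) (s≤s (s≤s (m≤n+m k a))))
      high : ∀ j → e ≤ j → get c j ≡ false
      high j e≤j with j <? k
      ... | no j≮k = beyondC j j≮k
      ... | yes j<k with a <? j
      ...   | yes a<j = trans (sym (atC j j<k)) (inWindow w (suc j) (s≤s a<j) (s≤s (s≤s (≤-trans (<⇒≤ j<k) (m≤n+m k a)))))
      ...   | no a≮j with lt-witness j<k
      ...     | v , jv = trans (sym (atMirror j v jv))
                           (inWindow w (suc (suc (k + v))) (s≤s (s≤s (≤-trans (<⇒≤ a<k) (m≤m+n k v))))
                                     (s≤s (s≤s (subst (k + v <_) (+-comm k a) (+-monoʳ-< k v<a)))))
        where v<a : v < a
              v<a = <-≤-trans (mirrorBelow j v e≤j jv) (≤-trans (m≤m+n s d) (≤-trans e≤j (≮⇒≥ a≮j)))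

    fromWindowInMirror : (∀ r → r < k → f (suc (suc k) + r) ≡ false) → longRun x c y ≡ true
    fromWindowInMirror w = byC (get⇒allFalse c letter)
      where letter : ∀ j → get c j ≡ false
            letter j with j <? k
            ... | no j≮k = beyondC j j≮k
            ... | yes j<k with lt-witness j<k
            ...   | v , jv = trans (sym (atMirror j v jv))
                               (inWindow w (suc (suc (k + v))) (s≤s (s≤s (m≤m+n k v))) (s≤s (s≤s (+-monoʳ-< k v<k))))
              where v<k : v < k
                    v<k = le-by (suc v) k j (trans (cong suc (+-comm v j)) jv)

    fromWindowThroughX : ∀ a → suc (suc (suc (k + a))) < N → (∀ r → r < k → f (suc (suc (suc (k + a))) + r) ≡ false) →
                         longRun x c y ≡ true
    fromWindowThroughX a start<N w = byX x0 (allFalse-take⇐ s c low)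
      where
      start : ℕ
      start = suc (suc (suc (k + a)))
      start≤N : ∀ j → start ≤ N + j
      start≤N j = ≤-trans (<⇒≤ start<N) (m≤m+n N j)
      x0 : x ≡ false
      x0 = trans (sym at0) (trans (sym (atN 0)) (inWindow w (N + 0) (start≤N 0)
             (subst (λ n → n + 0 < start + k) (sym N≡) (s≤s (s≤s (s≤s (subst (_≤ k + a + k) (sym (+-identityʳ (k + k)))
               (+-monoˡ-≤ k (m≤m+n k a)))))))))
      low : ∀ j → j < s → get c j ≡ false
      low j j<s with j <? a
      ... | yes j<a with lt-witness j<a
      ...   | g , refl = trans (sym (atC j (<-trans j<s s<k))) (trans (sym (atN (suc j)))
                           (inWindow w (N + suc j) (start≤N (suc j)) (subst (λ n → n + suc j < start + k) (sym N≡) (le-by _ _ g (shuffle k j g)))))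
        where shuffle : ∀ k j g → suc (suc (suc (k + k) + suc j)) + g ≡ suc (suc (suc (k + suc (j + g)))) + k
              shuffle = solve-∀
      low j j<s | no j≮a with lt-witness (<-trans j<s s<k)
      ...   | v , jv = trans (sym (atMirror j v jv))
                         (inWindow w (suc (suc (k + v))) (s≤s (s≤s (subst (_≤ k + v) (+-suc k a) (+-monoʳ-≤ k a<v))))
                                   (s≤s (s≤s (s≤s (subst (k + v ≤_) (sym (+-assoc k a k)) (+-monoʳ-≤ k (≤-trans (<⇒≤ v<k) (m≤n+m k a))))))))
        where
        a<v : a < v
        a<v = ≤-<-trans (≮⇒≥ j≮a) (<-≤-trans j<s (≤-trans (m≤m+n s d) (mirrorAbove j v j<s jv)))
        v<k : v < k
        v<k = le-by (suc v) k j (trans (cong suc (+-comm v j)) jv)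

    window⇒criterion : ZeroWindow k f → longRun x c y ≡ true
    window⇒criterion (i , w) = fromStart (i % N) (m%n<n i N)
      (λ r lt → trans (cyclic-periodic L (i % N + r) (i + r) (%-+ʳ (i % N) i r (m%n%n≡m%n i N))) (w r lt))
      where
      fromStart : ∀ i₀ → i₀ < N → (∀ r → r < k → f (i₀ + r) ≡ false) → longRun x c y ≡ true
      fromStart zero _ = fromWindowAt0
      fromStart (suc zero) _ = fromWindowAt1
      fromStart (suc (suc a)) lt with <-cmp a k
      ... | tri< a<k _ _ = fromWindowThroughY a a<k
      ... | tri≈ _ refl _ = fromWindowInMirror
      ... | tri> _ _ k<a with lt-witness k<a
      ...   | a′ , refl = fromWindowThroughX a′ lt

    palindrome-bad : badB N k f ≡ longRun x c y
    palindrome-bad = bool-ext (λ b → window⇒criterion (bad⇒window k f (≤double+2 k) b))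
                              (λ h → window⇒bad k f (cyclic-periodic L) k≥1 (criterion⇒window h))

module ClosedCounts where

  open import Data.Bool using (Bool; true; false; not; _∧_; _∨_)
  open import Data.Bool.Properties using (∧-comm; ∨-identityʳ; ∧-identityʳ; ∧-zeroʳ; ∧-distribʳ-∨)
  open import Data.Nat
  open import Data.Nat.Properties
  open import Data.Nat.Combinatorics using (_C_)
  open import Data.List using (List; take; drop)
  open import Data.List.Properties using (drop-drop)
  open import Relation.Binary.PropositionalEquality
  open Words
  open Lookup using (allFalse⇒get; allFalse-take⇐; allFalse-drop⇐)
  open PalindromeBadness using (module LongRun)

  ∧-cong-true : ∀ {a b c : Bool} → (a ≡ true → b ≡ c) → a ∧ b ≡ a ∧ c
  ∧-cong-true {true} h = h refl
  ∧-cong-true {false} h = refl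

  absorb : ∀ {a b : Bool} → (a ≡ true → b ≡ true) → a ∨ b ≡ b
  absorb {true} h = sym (h refl)
  absorb {false} h = refl

  absorb₂ : ∀ {a b c : Bool} → (a ≡ true → b ≡ true) → a ∨ b ∨ c ≡ b ∨ c
  absorb₂ {true} {b} {c} h rewrite h refl = refl
  absorb₂ {false} h = refl

  ∧-idem : ∀ b c o → (b ∧ o) ∧ (c ∧ o) ≡ b ∧ c ∧ o
  ∧-idem true true true = refl
  ∧-idem true true false = refl
  ∧-idem true false o = ∧-zeroʳ o
  ∧-idem false c o = refl

  double-≡ᵇ : ∀ a b → (a + a ≡ᵇ b + b) ≡ (a ≡ᵇ b)
  double-≡ᵇ zero zero = refl
  double-≡ᵇ zero (suc b) = refl
  double-≡ᵇ (suc a) zero = refl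
  double-≡ᵇ (suc a) (suc b) = trans (cong₂ _≡ᵇ_ (+-suc a a) (+-suc b b)) (double-≡ᵇ a b)

  odd-≡ᵇ-even : ∀ a b → (suc (a + a) ≡ᵇ b + b) ≡ false
  odd-≡ᵇ-even a zero = refl
  odd-≡ᵇ-even zero (suc b) = cong (0 ≡ᵇ_) (+-suc b b)
  odd-≡ᵇ-even (suc a) (suc b) = trans (cong₂ _≡ᵇ_ (cong suc (+-suc a a)) (+-suc b b)) (odd-≡ᵇ-even a b)

  even-≡ᵇ-odd : ∀ a b → (a + a ≡ᵇ suc (b + b)) ≡ false
  even-≡ᵇ-odd zero b = refl
  even-≡ᵇ-odd (suc a) zero = cong (_≡ᵇ 0) (+-suc a a)
  even-≡ᵇ-odd (suc a) (suc b) = trans (cong₂ _≡ᵇ_ (+-suc a a) (cong suc (+-suc b b))) (even-≡ᵇ-odd a b)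

  module PalindromeCounts (s d : ℕ) where
    open LongRun s d

    OfWeight : ℕ → List Bool → Bool
    OfWeight j c = weight c ≡ᵇ j

    count-prefixZero : ∀ G → (∀ l → prefixZero l ≡ true → G l ≡ G (drop s l)) →
                       count k (λ c → prefixZero c ∧ G c) ≡ count e G
    count-prefixZero G hG = trans (count-ext k (λ l _ → ∧-cong-true (hG l))) (count-zeroPrefix s e G)

    count-suffixZero : ∀ F → (∀ l → suffixZero l ≡ true → F l ≡ F (take e l)) →
                       count k (λ c → suffixZero c ∧ F c) ≡ count e F
    count-suffixZero F hF =
      trans (cong (λ n → count n (λ c → suffixZero c ∧ F c)) (+-comm s e))
            (trans (count-ext (e + s) (λ l _ → trans (∧-cong-true (hF l)) (∧-comm (suffixZero l) _)))
                   (count-zeroSuffix e s F))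

    count-bothZero : ∀ G → (∀ m → allFalse (drop d m) ≡ true → G m ≡ G (take d m)) →
                     count k (λ c → prefixZero c ∧ suffixZero c ∧ G (drop s c)) ≡ count d G
    count-bothZero G hG = begin
      count k (λ c → prefixZero c ∧ suffixZero c ∧ G (drop s c))
        ≡⟨ count-ext k (λ l _ → cong (λ z → prefixZero l ∧ allFalse z ∧ G (drop s l)) (drop-drop s d l)) ⟨
      count k (λ c → prefixZero c ∧ allFalse (drop d (drop s c)) ∧ G (drop s c))
        ≡⟨ count-zeroPrefix s e (λ m → allFalse (drop d m) ∧ G m) ⟩
      count (s + d) (λ m → allFalse (drop d m) ∧ G m)
        ≡⟨ cong (λ n → count n (λ m → allFalse (drop d m) ∧ G m)) (+-comm s d) ⟩
      count (d + s) (λ m → allFalse (drop d m) ∧ G m)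
        ≡⟨ count-ext (d + s) (λ m _ → trans (∧-cong-true (hG m)) (∧-comm (allFalse (drop d m)) _)) ⟩
      count (d + s) (λ m → G (take d m) ∧ allFalse (drop d m))
        ≡⟨ count-zeroSuffix d s G ⟩
      count d G ∎
      where open ≡-Reasoning

    count-prefixZero-all : count k prefixZero ≡ 2 ^ e
    count-prefixZero-all = trans (count-ext k (λ l _ → sym (∧-identityʳ (prefixZero l))))
                                 (trans (count-prefixZero (λ _ → true) (λ _ _ → refl)) (count-true e))

    count-suffixZero-all : count k suffixZero ≡ 2 ^ e
    count-suffixZero-all = trans (count-ext k (λ l _ → sym (∧-identityʳ (suffixZero l))))
                                 (trans (count-suffixZero (λ _ → true) (λ _ _ → refl)) (count-true e))

    count-bothZero-all : count k (λ c → prefixZero c ∧ suffixZero c) ≡ 2 ^ d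
    count-bothZero-all = trans (count-ext k (λ l _ → cong (prefixZero l ∧_) (sym (∧-identityʳ (suffixZero l)))))
                               (trans (count-bothZero (λ _ → true) (λ _ _ → refl)) (count-true d))

    count-prefixZero-weight : ∀ j → count k (λ c → prefixZero c ∧ OfWeight j c) ≡ e C j
    count-prefixZero-weight j = trans (count-prefixZero (OfWeight j) (λ l z → cong (_≡ᵇ j) (weight-zeroPrefix s l z)))
                                      (count-weight e j)

    count-suffixZero-weight : ∀ j → count k (λ c → suffixZero c ∧ OfWeight j c) ≡ e C j
    count-suffixZero-weight j = trans (count-suffixZero (OfWeight j) (λ l z → cong (_≡ᵇ j) (weight-zeroSuffix e l z)))
                                      (count-weight e j)

    count-bothZero-weight : ∀ j → count k (λ c → prefixZero c ∧ suffixZero c ∧ OfWeight j c) ≡ d C j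
    count-bothZero-weight j =
      trans (count-ext k (λ l _ → ∧-cong-true {prefixZero l} (λ z → cong (λ w → suffixZero l ∧ (w ≡ᵇ j)) (weight-zeroPrefix s l z))))
            (trans (count-bothZero (OfWeight j) (λ m z → cong (_≡ᵇ j) (weight-zeroSuffix d m z))) (count-weight d j))

    allFalse⇒prefixZero : ∀ c → allFalse c ≡ true → prefixZero c ≡ true
    allFalse⇒prefixZero c z = allFalse-take⇐ s c (λ j _ → allFalse⇒get c z j)

    allFalse⇒suffixZero : ∀ c → allFalse c ≡ true → suffixZero c ≡ true
    allFalse⇒suffixZero c z = allFalse-drop⇐ e c (λ j _ → allFalse⇒get c z j)

    noRun-TT : count k (λ c → not (longRun true c true)) + 1 ≡ 2 ^ k
    noRun-TT = trans (cong₂ _+_ (count-ext k (λ c _ → cong not (∨-identityʳ (allFalse c)))) (sym (count-allFalse k)))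
                     (count-not k allFalse)

    noRun-TF : count k (λ c → not (longRun true c false)) + 2 ^ e ≡ 2 ^ k
    noRun-TF = trans (cong₂ _+_ (count-ext k (λ c _ → cong not (absorb (allFalse⇒suffixZero c)))) (sym count-suffixZero-all))
                     (count-not k suffixZero)

    noRun-FT : count k (λ c → not (longRun false c true)) + 2 ^ e ≡ 2 ^ k
    noRun-FT = trans (cong₂ _+_ (count-ext k (λ c _ → cong not (trans (absorb₂ (allFalse⇒prefixZero c)) (∨-identityʳ (prefixZero c)))))
                                (sym count-prefixZero-all))
                     (count-not k prefixZero)

    noRun-FF : count k (λ c → not (longRun false c false)) + (2 ^ e + 2 ^ e) ≡ 2 ^ k + 2 ^ d
    noRun-FF = begin
      X + (2 ^ e + 2 ^ e)
        ≡⟨ cong (X +_) (sym (trans (count-∨ k prefixZero suffixZero) (cong₂ _+_ count-prefixZero-all count-suffixZero-all))) ⟩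
      X + (U + I)
        ≡⟨ +-assoc X U I ⟨
      (X + U) + I
        ≡⟨ cong₂ _+_ (trans (cong (_+ U) (count-ext k (λ c _ → cong not (absorb₂ (allFalse⇒prefixZero c))))) (count-not k (λ c → prefixZero c ∨ suffixZero c)))
                     count-bothZero-all ⟩
      2 ^ k + 2 ^ d ∎
      where
      open ≡-Reasoning
      X : ℕ
      X = count k (λ c → not (longRun false c false))
      U : ℕ
      U = count k (λ c → prefixZero c ∨ suffixZero c)
      I : ℕ
      I = count k (λ c → prefixZero c ∧ suffixZero c)

    NoRunOfWeight : Bool → Bool → ℕ → List Bool → Bool
    NoRunOfWeight x y m c = not (longRun x c y) ∧ (bit x + (weight c + (bit y + weight c)) ≡ᵇ m)

    count-avoiding : ∀ j X → count k (λ c → OfWeight j c ∧ not (X c)) + count k (λ c → X c ∧ OfWeight j c) ≡ k C j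
    count-avoiding j X = trans (cong (count k (λ c → OfWeight j c ∧ not (X c)) +_) (count-ext k (λ c _ → ∧-comm (X c) (OfWeight j c))))
                               (trans (count-partition k (OfWeight j) X) (count-weight k j))

    module EvenWeight (d≤1 : d ≤ 1) (j₂ : ℕ) where
      j : ℕ
      j = suc (suc j₂)

      FF : count k (NoRunOfWeight false false (j + j)) + (e C j + e C j) ≡ k C j
      FF = begin
        F + (e C j + e C j)
          ≡⟨ cong (F +_) (sym (trans (count-∨ k (λ c → prefixZero c ∧ OfWeight j c) (λ c → suffixZero c ∧ OfWeight j c))
                                     (cong₂ _+_ (count-prefixZero-weight j) (count-suffixZero-weight j)))) ⟩
        F + (U + I)
          ≡⟨ cong (λ z → F + (U + z)) (trans (count-ext k (λ c _ → ∧-idem (prefixZero c) (suffixZero c) (OfWeight j c)))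
                                             (trans (count-bothZero-weight j) (few d d≤1))) ⟩
        F + (U + 0)
          ≡⟨ cong (F +_) (+-identityʳ U) ⟩
        F + U
          ≡⟨ cong₂ _+_ simplified (count-ext k (λ c _ → sym (∧-distribʳ-∨ (OfWeight j c) (prefixZero c) (suffixZero c)))) ⟩
        count k (λ c → OfWeight j c ∧ not (prefixZero c ∨ suffixZero c)) + count k (λ c → (prefixZero c ∨ suffixZero c) ∧ OfWeight j c)
          ≡⟨ count-avoiding j (λ c → prefixZero c ∨ suffixZero c) ⟩
        k C j ∎
        where
        open ≡-Reasoning
        F : ℕ
        F = count k (NoRunOfWeight false false (j + j))
        U : ℕ
        U = count k (λ c → (prefixZero c ∧ OfWeight j c) ∨ (suffixZero c ∧ OfWeight j c))
        I : ℕ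
        I = count k (λ c → (prefixZero c ∧ OfWeight j c) ∧ (suffixZero c ∧ OfWeight j c))
        few : ∀ d → d ≤ 1 → d C j ≡ 0
        few zero _ = refl
        few (suc zero) _ = refl
        few (suc (suc _)) (s≤s ())
        simplified : F ≡ count k (λ c → OfWeight j c ∧ not (prefixZero c ∨ suffixZero c))
        simplified = count-ext k (λ c _ → trans (cong (not (longRun false c false) ∧_) (double-≡ᵇ (weight c) j))
          (trans (cong (λ z → not z ∧ OfWeight j c) (absorb₂ (allFalse⇒prefixZero c))) (∧-comm _ (OfWeight j c))))

      FT : count k (NoRunOfWeight false true (j + j)) ≡ 0
      FT = trans (count-ext k (λ c _ → trans (cong (λ z → not (longRun false c true) ∧ (z ≡ᵇ j + j)) (+-suc (weight c) (weight c)))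
                                      (trans (cong (not (longRun false c true) ∧_) (odd-≡ᵇ-even (weight c) j)) (∧-zeroʳ _))))
                 (count-false k)

      TF : count k (NoRunOfWeight true false (j + j)) ≡ 0
      TF = trans (count-ext k (λ c _ → trans (cong (not (longRun true c false) ∧_) (odd-≡ᵇ-even (weight c) j)) (∧-zeroʳ _)))
                 (count-false k)

      TT : count k (NoRunOfWeight true true (j + j)) ≡ k C suc j₂
      TT = trans (count-ext k (λ c _ → trans (cong (λ z → not (longRun true c true) ∧ (suc z ≡ᵇ j + j)) (+-suc (weight c) (weight c)))
                             (trans (cong (not (longRun true c true) ∧_)
                                          (trans (cong (suc (weight c + weight c) ≡ᵇ_) (+-suc (suc j₂) (suc j₂))) (double-≡ᵇ (weight c) (suc j₂))))
                                    (nonzero c))))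
                 (count-weight k (suc j₂))
        where
        -- Weight j₂ + 1 ≥ 1 already excludes the all-zero word.
        nonzero : ∀ c → not (longRun true c true) ∧ OfWeight (suc j₂) c ≡ OfWeight (suc j₂) c
        nonzero c with allFalse c in z
        ... | true = cong (_≡ᵇ suc j₂) (sym (weight-allFalse c z))
        ... | false = refl

    module OddWeight (j : ℕ) where
      FF : count k (NoRunOfWeight false false (suc (j + j))) ≡ 0
      FF = trans (count-ext k (λ c _ → trans (cong (not (longRun false c false) ∧_) (even-≡ᵇ-odd (weight c) j)) (∧-zeroʳ _)))
                 (count-false k)

      TT : count k (NoRunOfWeight true true (suc (j + j))) ≡ 0
      TT = trans (count-ext k (λ c _ → trans (cong (λ z → not (longRun true c true) ∧ (z ≡ᵇ j + j)) (+-suc (weight c) (weight c)))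
                             (trans (cong (not (longRun true c true) ∧_) (odd-≡ᵇ-even (weight c) j)) (∧-zeroʳ _))))
                 (count-false k)

      TF : count k (NoRunOfWeight true false (suc (j + j))) + e C j ≡ k C j
      TF = trans (cong₂ _+_ (count-ext k (λ c _ → trans (cong (not (longRun true c false) ∧_) (double-≡ᵇ (weight c) j))
                                           (trans (∧-comm _ (OfWeight j c)) (cong (λ z → OfWeight j c ∧ not z) (absorb (allFalse⇒suffixZero c))))))
                            (sym (count-suffixZero-weight j)))
                 (count-avoiding j suffixZero)

      FT : count k (NoRunOfWeight false true (suc (j + j))) + e C j ≡ k C j
      FT = trans (cong₂ _+_ (count-ext k (λ c _ → trans (cong (λ z → not (longRun false c true) ∧ (z ≡ᵇ suc (j + j))) (+-suc (weight c) (weight c)))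
                                           (trans (cong (not (longRun false c true) ∧_) (double-≡ᵇ (weight c) j))
                                           (trans (∧-comm _ (OfWeight j c))
                                                  (cong (λ z → OfWeight j c ∧ not z) (trans (absorb₂ (allFalse⇒prefixZero c)) (∨-identityʳ (prefixZero c))))))))
                            (sym (count-prefixZero-weight j)))
                 (count-avoiding j prefixZero)

module Bridge where

  open import Defs
  open import Data.Bool using (Bool; true; false; not; _∧_; _∨_)
  open import Data.Nat
  open import Data.Nat.Properties
  open import Data.Nat.DivMod
  open import Data.Nat.Tactic.RingSolver using (solve-∀)
  open import Data.Fin using (Fin; toℕ; fromℕ<) renaming (zero to fzero; suc to fsuc)
  open import Data.Fin.Properties using (toℕ-fromℕ<; toℕ-injective; toℕ<n)
  open import Data.List using (List; []; _∷_; tabulate; allFin; filterᵇ; concatMap; length)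
  open import Data.List.Membership.Propositional using (_∈_)
  open import Data.List.Membership.Propositional.Properties using (∈-allFin)
  open import Data.List.Relation.Unary.Any using (here; there)
  open import Data.Bool.ListAction using (all)
  open import Data.Vec.Functional using () renaming (_∷_ to _◂_)
  open import Data.Product using (Σ; _,_; _×_; proj₁; proj₂)
  open import Relation.Binary.PropositionalEquality
  open import Relation.Nullary using (contradiction)
  open Words
  open Palindromes using (_==_; ≡⇒==; ==⇒≡)
  open Lookup
  open Cyclic
  open ReflectionSymmetry

  tally : ∀ {A : Set} → (A → Bool) → List A → ℕ
  tally p [] = 0
  tally p (x ∷ xs) = bit (p x) + tally p xs

  length-filterᵇ : ∀ {A : Set} (p : A → Bool) xs → length (filterᵇ p xs) ≡ tally p xs
  length-filterᵇ p [] = refl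
  length-filterᵇ p (x ∷ xs) with p x
  ... | true = cong suc (length-filterᵇ p xs)
  ... | false = length-filterᵇ p xs

  -- Enumerating allTuples n amounts to branching on the first entry, as count does.
  tally-allTuples : ∀ n (P : Tuple n → Bool) (P′ : List Bool → Bool) → (∀ a → P a ≡ P′ (tabulate a)) →
                    tally P (allTuples n) ≡ count n P′
  tally-allTuples zero P P′ h = trans (+-identityʳ _) (cong bit (h (λ ())))
  tally-allTuples (suc n) P P′ h = trans (branch (allTuples n))
    (cong₂ _+_ (tally-allTuples n (λ a → P (false ◂ a)) (λ l → P′ (false ∷ l)) (λ a → h (false ◂ a)))
               (tally-allTuples n (λ a → P (true ◂ a)) (λ l → P′ (true ∷ l)) (λ a → h (true ◂ a))))
    where
    branch : ∀ xs → tally P (concatMap (λ a → (false ◂ a) ∷ (true ◂ a) ∷ []) xs)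
                    ≡ tally (λ a → P (false ◂ a)) xs + tally (λ a → P (true ◂ a)) xs
    branch [] = refl
    branch (x ∷ xs) = trans (cong (λ z → bit (P (false ◂ x)) + (bit (P (true ◂ x)) + z)) (branch xs))
                             (shuffle (bit (P (false ◂ x))) (bit (P (true ◂ x))) (tally (λ a → P (false ◂ a)) xs) (tally (λ a → P (true ◂ a)) xs))
      where shuffle : ∀ a b c d → a + (b + (c + d)) ≡ (a + c) + (b + d)
            shuffle = solve-∀

  get-tabulate : ∀ {n} (a : Fin n → Bool) (i : Fin n) → get (tabulate a) (toℕ i) ≡ a i
  get-tabulate {suc n} a fzero = refl
  get-tabulate {suc n} a (fsuc i) = get-tabulate (λ x → a (fsuc x)) i

  all-∈ : ∀ {A : Set} {p : A → Bool} {xs : List A} → all p xs ≡ true → ∀ {x} → x ∈ xs → p x ≡ true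
  all-∈ {p = p} {x ∷ xs} h (here refl) = proj₁ (∧-true {p x} h)
  all-∈ {p = p} {x ∷ xs} h (there m) = all-∈ (proj₂ (∧-true {p x} h)) m

  all-witness : ∀ {A : Set} {p : A → Bool} (xs : List A) → all p xs ≡ false → Σ A λ x → p x ≡ false
  all-witness {p = p} (x ∷ xs) h with p x in e
  ... | false = x , e
  ... | true = all-witness xs h

  -- isFixedBy compares entries with an equality test local to Defs; it is evaluated here by case
  -- analysis on the two entries, after abstracting them.
  fixedBy⇒ : ∀ n q (a : Tuple n) → isFixedBy n q a ≡ true → ∀ i → a (reflection n q i) ≡ a i
  fixedBy⇒ n q a h i with all-∈ h (∈-allFin i)
  ... | e with a (reflection n q i) | a i
  ... | true | true = refl
  ... | false | false = refl
  ... | true | false = true≢false (sym e)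
  ... | false | true = true≢false (sym e)

  fixedBy⇐ : ∀ n q (a : Tuple n) → (∀ i → a (reflection n q i) ≡ a i) → isFixedBy n q a ≡ true
  fixedBy⇐ n q a h with isFixedBy n q a in e
  ... | true = refl
  ... | false with all-witness (allFin n) e
  ... | i , e′ with a (reflection n q i) | a i | h i
  ... | true | true | _ = true≢false e′
  ... | false | false | _ = true≢false e′

  module Tuples (n′ : ℕ) where
    open Period n′
    open Reflections n′

    at≡cyclic : ∀ (a : Tuple N) j → at a j ≡ cyclic (tabulate a) j
    at≡cyclic a j = sym (trans (cong (get (tabulate a)) (sym (toℕ-fromℕ< (m%n<n j N)))) (get-tabulate a _))

    mod-toℕ : ∀ (i : Fin N) → toℕ i mod N ≡ i
    mod-toℕ i = toℕ-injective (trans (toℕ-fromℕ< _) (m<n⇒m%n≡m (toℕ<n i)))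

    isBad≡ : ∀ (a : Tuple N) → isBad a ≡ badB N (threshold N) (cyclic (tabulate a))
    isBad≡ a = badB-ext N (threshold N) (at≡cyclic a)

    ones≡weight : ∀ (a : Tuple N) → ones a ≡ weight (tabulate a)
    ones≡weight a = trans (length-filterᵇ a (allFin N)) (tally-tabulate (λ i → i))
      where tally-tabulate : ∀ {m} (F : Fin m → Fin N) → tally a (tabulate F) ≡ weight (tabulate (λ i → a (F i)))
            tally-tabulate {zero} F = refl
            tally-tabulate {suc m} F = cong (bit (a (F fzero)) +_) (tally-tabulate (λ i → F (fsuc i)))

    entry : ∀ (a : Tuple N) i (lt : i < N) → a (fromℕ< lt) ≡ at a i
    entry a i lt = cong a (toℕ-injective (trans (toℕ-fromℕ< lt) (sym (trans (toℕ-fromℕ< (m%n<n i N)) (m<n⇒m%n≡m lt)))))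

    isFixedBy≡ : ∀ q (a : Tuple N) → isFixedBy N q a ≡ reflFixedB q (cyclic (tabulate a))
    isFixedBy≡ q a = bool-ext
      (λ h → true-all N (λ i → i) _ (λ i lt → ≡⇒== (to i lt (fixedBy⇒ N q a h (fromℕ< lt)))))
      (λ h → fixedBy⇐ N q a (from h))
      where
      l : List Bool
      l = tabulate a
      to : ∀ i (lt : i < N) → a (reflection N q (fromℕ< lt)) ≡ a (fromℕ< lt) → cyclic l (q + (N ∸ i)) ≡ cyclic l i
      to i lt e = trans (sym (at≡cyclic a (q + (N ∸ i))))
        (trans (cong (λ t → at a (q + (N ∸ t))) (sym (toℕ-fromℕ< lt))) (trans e (trans (entry a i lt) (at≡cyclic a i))))
      from : reflFixedB q (cyclic l) ≡ true → ∀ x → a (reflection N q x) ≡ a x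
      from h x = trans (at≡cyclic a (q + (N ∸ toℕ x)))
        (trans (==⇒≡ (all-true N (λ i → i) (λ i → cyclic l (q + (N ∸ i)) == cyclic l i) h (toℕ x) (toℕ<n x)))
               (trans (sym (at≡cyclic a (toℕ x))) (cong a (mod-toℕ x))))

  threshold-even : ∀ h → threshold (h * 2) ≡ h ∸ 1
  threshold-even h rewrite m*n%n≡0 h 2 {{_}} | m*n/n≡m h 2 {{_}} = refl

  fixedPoint-equation : ∀ n′ q (x : Fin (suc n′)) → toℕ (reflection (suc n′) q x) ≡ toℕ x →
                        Σ ℕ λ K → q + suc n′ ≡ toℕ x + K * suc n′ + toℕ x
  fixedPoint-equation n′ q x fixed = M / N , (begin
    q + N ≡⟨ cong (q +_) (m∸n+n≡m (<⇒≤ (toℕ<n x))) ⟨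
    q + ((N ∸ v) + v) ≡⟨ +-assoc q (N ∸ v) v ⟨
    M + v ≡⟨ cong (_+ v) (m≡m%n+[m/n]*n M N) ⟩
    M % N + M / N * N + v ≡⟨ cong (λ z → z + M / N * N + v) (trans (sym (toℕ-fromℕ< (m%n<n M N))) fixed) ⟩
    v + M / N * N + v ∎)
    where
    open ≡-Reasoning
    N : ℕ
    N = suc n′
    v : ℕ
    v = toℕ x
    M : ℕ
    M = q + (N ∸ v)

  even-reflection : ∀ h q → numFixedPoints (suc h * 2) q ≡ 2 → q % 2 ≡ 0
  even-reflection h q two with q % 2 in parity
  ... | zero = refl
  ... | suc (suc r) = contradiction (m%n<n q 2) (λ lt → <-irrefl refl (<-≤-trans (subst (_< 2) parity lt) (s≤s (s≤s z≤n))))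
  ... | suc zero = contradiction (trans (sym (trans (length-filterᵇ isFixedPoint (allFin N)) (tally-none (allFin N) noFixedPoint))) two) λ ()
    where
    N : ℕ
    N = suc h * 2
    isFixedPoint : Fin N → Bool
    isFixedPoint x = toℕ (reflection N q x) ≡ᵇ toℕ x
    tally-none : ∀ {A : Set} {p : A → Bool} xs → (∀ x → p x ≡ false) → tally p xs ≡ 0
    tally-none [] _ = refl
    tally-none {p = p} (x ∷ xs) h rewrite h x = tally-none xs h
    noFixedPoint : ∀ x → isFixedPoint x ≡ false
    noFixedPoint x with toℕ (reflection N q x) ≡ᵇ toℕ x in e
    ... | false = refl
    ... | true with fixedPoint-equation (suc (h * 2)) q x (≡ᵇ⇒≡ _ _ (true⇒T e))
    ...   | K , eq = contradiction (trans (sym parity) even) λ ()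
      where
      v : ℕ
      v = toℕ x
      even : q % 2 ≡ 0
      even = begin
        q % 2 ≡⟨ [m+kn]%n≡m%n q (suc h) 2 ⟨
        (q + N) % 2 ≡⟨ cong (_% 2) eq ⟩
        (v + K * N + v) % 2 ≡⟨ cong (_% 2) (double v K h) ⟩
        ((v + K * suc h) * 2) % 2 ≡⟨ m*n%n≡0 (v + K * suc h) 2 ⟩
        0 ∎
        where open ≡-Reasoning
              double : ∀ v K h → v + K * (suc h * 2) + v ≡ (v + K * suc h) * 2
              double = solve-∀

module Assembly where

  open import Defs
  open import Data.Bool using (Bool; true; false; not; _∧_; _∨_)
  open import Data.Bool.Properties using (∧-assoc)
  open import Data.Nat
  open import Data.Nat.Properties
  open import Data.Nat.Combinatorics using (_C_; nCk+nC[k+1]≡[n+1]C[k+1])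
  open import Data.Nat.Tactic.RingSolver using (solve-∀)
  open import Data.List using (List; _∷_; _++_; length; reverse; tabulate)
  open import Relation.Binary.PropositionalEquality
  open Words
  open Palindromes
  open Cyclic
  open ReflectionSymmetry
  open PalindromeBadness
  open ClosedCounts
  open Bridge

  module FixedCounts (s d : ℕ) (d≤1 : d ≤ 1) (k≥1 : 1 ≤ s + (s + d)) (q p : ℕ) (q≡2p : q ≡ p + p) where
    open LongRun s d
    open PalindromeCounts s d
    n′ : ℕ
    n′ = suc (double k)
    open Period n′
    open Reflections n′
    open Tuples n′

    Good : List Bool → Bool
    Good l = not (badB N k (cyclic l))

    isGood≡ : ∀ (a : Tuple N) → isGood a ≡ Good (tabulate a)
    isGood≡ a = cong not (trans (isBad≡ a) (cong (λ t → badB N t (cyclic (tabulate a))) threshold≡k))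
      where threshold≡k : threshold N ≡ k
            threshold≡k = trans (cong threshold (double+2≡ k)) (threshold-even (suc k))

    fixG≡count : fixG N q ≡ count N (λ l → Good l ∧ reflFixedB q (cyclic l))
    fixG≡count = trans (length-filterᵇ _ (allTuples N))
      (tally-allTuples N _ (λ l → Good l ∧ reflFixedB q (cyclic l)) (λ a → cong₂ _∧_ (isGood≡ a) (isFixedBy≡ q a)))

    fixGm≡count : ∀ m → fixGm m N q ≡ count N (λ l → (Good l ∧ (weight l ≡ᵇ m)) ∧ reflFixedB q (cyclic l))
    fixGm≡count m = trans (length-filterᵇ _ (allTuples N))
      (tally-allTuples N _ (λ l → (Good l ∧ (weight l ≡ᵇ m)) ∧ reflFixedB q (cyclic l)) (λ a → trans (sym (∧-assoc (isGood a) (ones a ≡ᵇ m) (isFixedBy N q a)))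
        (cong₂ _∧_ (cong₂ _∧_ (isGood≡ a) (cong (_≡ᵇ m) (ones≡weight a))) (isFixedBy≡ q a))))

    Good-rotateBy : ∀ l → length l ≡ N → Good (rotateBy (n′ * p) l) ≡ Good l
    Good-rotateBy l len = cong not (bad-rotateBy k (n′ * p) l len k≥1 (≤double+2 k))

    Good-palindrome : ∀ x c y → length c ≡ k → Good (x ∷ (c ++ y ∷ reverse c)) ≡ not (longRun x c y)
    Good-palindrome x c y lc = cong not (PalindromeWindows.palindrome-bad s d d≤1 k≥1 x c y lc)

    fixG-palindromes : fixG N q ≡ (count k (λ c → not (longRun false c false)) + count k (λ c → not (longRun false c true)))
                                 + (count k (λ c → not (longRun true c false)) + count k (λ c → not (longRun true c true)))
    fixG-palindromes = trans fixG≡count (trans (count-reflectionFixed k q p Good q≡2p Good-rotateBy)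
      (cong₂ _+_ (cong₂ _+_ (ends false false) (ends false true)) (cong₂ _+_ (ends true false) (ends true true))))
      where ends : ∀ x y → count k (λ c → Good (x ∷ (c ++ y ∷ reverse c))) ≡ count k (λ c → not (longRun x c y))
            ends x y = count-ext k (λ c lc → Good-palindrome x c y lc)

    fixGm-palindromes : ∀ m → fixGm m N q ≡ (count k (NoRunOfWeight false false m) + count k (NoRunOfWeight false true m))
                                           + (count k (NoRunOfWeight true false m) + count k (NoRunOfWeight true true m))
    fixGm-palindromes m = trans (fixGm≡count m) (trans (count-reflectionFixed k q p (λ l → Good l ∧ (weight l ≡ᵇ m)) q≡2p
        (λ l len → cong₂ _∧_ (Good-rotateBy l len) (cong (_≡ᵇ m) (weight-rotateBy (n′ * p) l))))
      (cong₂ _+_ (cong₂ _+_ (ends false false) (ends false true)) (cong₂ _+_ (ends true false) (ends true true))))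
      where ends : ∀ x y → count k (λ c → Good (x ∷ (c ++ y ∷ reverse c)) ∧ (weight (x ∷ (c ++ y ∷ reverse c)) ≡ᵇ m))
                           ≡ count k (NoRunOfWeight x y m)
            ends x y = count-ext k (λ c lc → cong₂ _∧_ (Good-palindrome x c y lc) (cong (_≡ᵇ m) (weight-palindrome x c y)))

    fixG-formula : fixG N q + 2 ^ (2 + e) + 1 ≡ 2 ^ (2 + k) + 2 ^ d
    fixG-formula = begin
      fixG N q + 2 ^ (2 + e) + 1
        ≡⟨ cong (λ z → z + 2 ^ (2 + e) + 1) fixG-palindromes ⟩
      ((FF + FT) + (TF + TT)) + 2 * (2 * E) + 1
        ≡⟨ regroup FF FT TF TT E ⟩
      (FF + (E + E)) + (FT + E) + (TF + E) + (TT + 1)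
        ≡⟨ cong₂ _+_ (cong₂ _+_ (cong₂ _+_ noRun-FF noRun-FT) noRun-TF) noRun-TT ⟩
      (K + 2 ^ d) + K + K + K
        ≡⟨ collect K (2 ^ d) ⟩
      2 ^ (2 + k) + 2 ^ d ∎
      where
      open ≡-Reasoning
      E : ℕ
      E = 2 ^ e
      K : ℕ
      K = 2 ^ k
      FF : ℕ
      FF = count k (λ c → not (longRun false c false))
      FT : ℕ
      FT = count k (λ c → not (longRun false c true))
      TF : ℕ
      TF = count k (λ c → not (longRun true c false))
      TT : ℕ
      TT = count k (λ c → not (longRun true c true))
      regroup : ∀ a b c t E → ((a + b) + (c + t)) + 2 * (2 * E) + 1 ≡ (a + (E + E)) + (b + E) + (c + E) + (t + 1)
      regroup = solve-∀
      collect : ∀ K D → (K + D) + K + K + K ≡ 2 * (2 * K) + D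
      collect = solve-∀

    fixGm-even : ∀ j₂ → let j = suc (suc j₂) in fixGm (j + j) N q + (e C j + e C j) ≡ suc k C j
    fixGm-even j₂ = begin
      fixGm m N q + (X + X)
        ≡⟨ cong (_+ (X + X)) (fixGm-palindromes m) ⟩
      ((FF + FT) + (TF + TT)) + (X + X)
        ≡⟨ cong₂ (λ a b → ((FF + a) + (b + TT)) + (X + X)) Even.FT Even.TF ⟩
      ((FF + 0) + (0 + TT)) + (X + X)
        ≡⟨ regroup FF TT (X + X) ⟩
      TT + (FF + (X + X))
        ≡⟨ cong₂ _+_ Even.TT Even.FF ⟩
      k C suc j₂ + k C j
        ≡⟨ nCk+nC[k+1]≡[n+1]C[k+1] k (suc j₂) ⟩
      suc k C j ∎
      where
      open ≡-Reasoning
      module Even = EvenWeight d≤1 j₂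
      j : ℕ
      j = suc (suc j₂)
      m : ℕ
      m = j + j
      X : ℕ
      X = e C j
      FF : ℕ
      FF = count k (NoRunOfWeight false false m)
      FT : ℕ
      FT = count k (NoRunOfWeight false true m)
      TF : ℕ
      TF = count k (NoRunOfWeight true false m)
      TT : ℕ
      TT = count k (NoRunOfWeight true true m)
      regroup : ∀ a b c → ((a + 0) + (0 + b)) + c ≡ b + (a + c)
      regroup = solve-∀

    fixGm-odd : ∀ j → fixGm (suc (j + j)) N q + (e C j + e C j) ≡ k C j + k C j
    fixGm-odd j = begin
      fixGm m N q + (X + X)
        ≡⟨ cong (_+ (X + X)) (fixGm-palindromes m) ⟩
      ((FF + FT) + (TF + TT)) + (X + X)
        ≡⟨ cong₂ (λ a b → ((a + FT) + (TF + b)) + (X + X)) Odd.FF Odd.TT ⟩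
      ((0 + FT) + (TF + 0)) + (X + X)
        ≡⟨ regroup FT TF X ⟩
      (TF + X) + (FT + X)
        ≡⟨ cong₂ _+_ Odd.TF Odd.FT ⟩
      k C j + k C j ∎
      where
      open ≡-Reasoning
      module Odd = OddWeight j
      m : ℕ
      m = suc (j + j)
      X : ℕ
      X = e C j
      FF : ℕ
      FF = count k (NoRunOfWeight false false m)
      FT : ℕ
      FT = count k (NoRunOfWeight false true m)
      TF : ℕ
      TF = count k (NoRunOfWeight true false m)
      TT : ℕ
      TT = count k (NoRunOfWeight true true m)
      regroup : ∀ a b c → ((0 + a) + (b + 0)) + (c + c) ≡ (b + c) + (a + c)
      regroup = solve-∀

open import Defs
open import Data.Nat using (ℕ; _≤_; _%_; _/_; _^_; _∸_) renaming (_+_ to _+ℕ_)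
open import Data.Nat.Combinatorics using (_C_)
open import Data.Integer using (+_; _-_; _+_; _*_)
open import Data.Product using (_×_; Σ; _,_)
open import Relation.Binary.PropositionalEquality using (_≡_; refl; sym; trans; cong; cong₂; subst)

import Data.Nat as ℕ
import Data.Nat.Properties as ℕₚ
import Data.Integer.Properties as ℤₚ
open import Data.Nat.DivMod using (m≡m%n+[m/n]*n; m%n<n; [m+kn]%n≡m%n; m<n⇒m%n≡m; +-distrib-/; m<n⇒m/n≡0; m*n%n≡0; m*n/n≡m)
open import Data.Nat.Tactic.RingSolver as ℕ-Solver using ()
open import Data.Integer.Tactic.RingSolver as ℤ-Solver using ()
open import Relation.Nullary using (contradiction)
open Palindromes using (double; double≡+; double+2≡)
open PalindromeBadness using (module LongRun)
open Bridge using (even-reflection)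
open Assembly using (module FixedCounts)

ℤ-difference : ∀ a c b → a +ℕ c ≡ b → + a ≡ + b - + c
ℤ-difference a c b h = trans (undo (+ a) (+ c)) (cong (_- + c) (trans (sym (ℤₚ.pos-+ a c)) (cong +_ h)))
  where undo : ∀ a c → a ≡ (a + c) - c
        undo = ℤ-Solver.solve-∀

ℤ-twice : ∀ b → + (b +ℕ b) ≡ + 2 * + b
ℤ-twice b = trans (cong +_ (cong (b +ℕ_) (sym (ℕₚ.+-identityʳ b)))) (ℤₚ.pos-* 2 b)

quotient : ∀ r q n → r ℕ.< ℕ.suc n → (r +ℕ q ℕ.* ℕ.suc n) / ℕ.suc n ≡ q
quotient r q n lt = trans (+-distrib-/ r (q ℕ.* ℕ.suc n) small) (cong₂ _+ℕ_ (m<n⇒m/n≡0 lt) (m*n/n≡m q (ℕ.suc n)))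
  where small : r % ℕ.suc n +ℕ (q ℕ.* ℕ.suc n) % ℕ.suc n ℕ.< ℕ.suc n
        small = subst (ℕ._< ℕ.suc n) (sym (trans (cong₂ _+ℕ_ (m<n⇒m%n≡m lt) (m*n%n≡0 q (ℕ.suc n))) (ℕₚ.+-identityʳ r))) lt

remainder : ∀ r q n → r ℕ.< ℕ.suc n → (r +ℕ q ℕ.* ℕ.suc n) % ℕ.suc n ≡ r
remainder r q n lt = trans ([m+kn]%n≡m%n r q (ℕ.suc n)) (m<n⇒m%n≡m lt)

halving : ∀ m r → m % 2 ≡ r → m ≡ r +ℕ (m / 2 +ℕ m / 2)
halving m r h = trans (m≡m%n+[m/n]*n m 2) (trans (cong (_+ℕ (m / 2) ℕ.* 2) h) (cong (r +ℕ_) (twice (m / 2))))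
  where twice : ∀ p → p ℕ.* 2 ≡ p +ℕ p
        twice = ℕ-Solver.solve-∀

evenShape : ∀ n → 4 ≤ n → n % 2 ≡ 0 →
  Σ ℕ λ s → Σ ℕ λ d → d ≤ 1 × 1 ≤ s +ℕ (s +ℕ d) × n ≡ ℕ.suc (ℕ.suc (double (s +ℕ (s +ℕ d))))
evenShape n 4≤n even with n / 2 | halving n 0 even | 4≤n
... | 0 | refl | ()
... | 1 | refl | ℕ.s≤s (ℕ.s≤s ())
... | ℕ.suc (ℕ.suc k′) | refl | _ = k / 2 , k % 2 , ℕₚ.≤-pred (m%n<n k 2) , subst (1 ≤_) k≡2s+d (ℕ.s≤s ℕ.z≤n) ,
      trans (cong ℕ.suc (ℕₚ.+-suc k k)) (cong (λ z → ℕ.suc (ℕ.suc z)) (trans (cong (λ z → z +ℕ z) k≡2s+d) (sym (double≡+ _))))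
  where
  k : ℕ
  k = ℕ.suc k′
  k≡2s+d : k ≡ k / 2 +ℕ (k / 2 +ℕ k % 2)
  k≡2s+d = trans (halving k (k % 2) refl) (shuffle (k % 2) (k / 2))
    where shuffle : ∀ d s → d +ℕ (s +ℕ s) ≡ s +ℕ (s +ℕ d)
          shuffle = ℕ-Solver.solve-∀

module Numerics (s d : ℕ) where
  open LongRun s d

  n : ℕ
  n = ℕ.suc (ℕ.suc (double k))

  n≡ : n ≡ ℕ.suc (ℕ.suc (k +ℕ k))
  n≡ = cong (λ z → ℕ.suc (ℕ.suc z)) (double≡+ k)

  byShape : ∀ {m} r q → m ≡ r +ℕ q ℕ.* 4 → r ℕ.< 4 → m / 4 ≡ q
  byShape r q eq lt = trans (cong (_/ 4) eq) (quotient r q 3 lt)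

  half : n / 2 ≡ ℕ.suc k
  half = trans (cong (_/ 2) (trans n≡ (shape s d))) (quotient 0 (ℕ.suc k) 1 (ℕ.s≤s ℕ.z≤n))
    where shape : ∀ s d → ℕ.suc (ℕ.suc ((s +ℕ (s +ℕ d)) +ℕ (s +ℕ (s +ℕ d)))) ≡ 0 +ℕ ℕ.suc (s +ℕ (s +ℕ d)) ℕ.* 2
          shape = ℕ-Solver.solve-∀

  half+2 : (n +ℕ 2) / 2 ≡ 2 +ℕ k
  half+2 = trans (cong (λ z → (z +ℕ 2) / 2) n≡) (trans (cong (_/ 2) (shape s d)) (quotient 0 (2 +ℕ k) 1 (ℕ.s≤s ℕ.z≤n)))
    where shape : ∀ s d → ℕ.suc (ℕ.suc ((s +ℕ (s +ℕ d)) +ℕ (s +ℕ (s +ℕ d)))) +ℕ 2 ≡ 0 +ℕ (2 +ℕ (s +ℕ (s +ℕ d))) ℕ.* 2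
          shape = ℕ-Solver.solve-∀

module Shape₀ (s : ℕ) where
  open Numerics s 0

  shape : n ≡ 2 +ℕ s ℕ.* 4
  shape = trans n≡ (ring s)
    where ring : ∀ s → ℕ.suc (ℕ.suc ((s +ℕ (s +ℕ 0)) +ℕ (s +ℕ (s +ℕ 0)))) ≡ 2 +ℕ s ℕ.* 4
          ring = ℕ-Solver.solve-∀

  residue : n % 4 ≡ 2
  residue = trans (cong (_% 4) shape) (remainder 2 s 3 (ℕ.s≤s (ℕ.s≤s (ℕ.s≤s ℕ.z≤n))))

  quarter : n / 4 ≡ s +ℕ 0
  quarter = trans (byShape 2 s shape (ℕ.s≤s (ℕ.s≤s (ℕ.s≤s ℕ.z≤n)))) (sym (ℕₚ.+-identityʳ s))

  quarter+6 : (n +ℕ 6) / 4 ≡ 2 +ℕ (s +ℕ 0)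
  quarter+6 = byShape 0 (2 +ℕ (s +ℕ 0)) (trans (cong (_+ℕ 6) shape) (ring s)) (ℕ.s≤s ℕ.z≤n)
    where ring : ∀ s → 2 +ℕ s ℕ.* 4 +ℕ 6 ≡ 0 +ℕ (2 +ℕ (s +ℕ 0)) ℕ.* 4
          ring = ℕ-Solver.solve-∀

module Shape₁ (s : ℕ) where
  open Numerics s 1

  shape : n ≡ 0 +ℕ (s +ℕ 1) ℕ.* 4
  shape = trans n≡ (ring s)
    where ring : ∀ s → ℕ.suc (ℕ.suc ((s +ℕ (s +ℕ 1)) +ℕ (s +ℕ (s +ℕ 1)))) ≡ 0 +ℕ (s +ℕ 1) ℕ.* 4
          ring = ℕ-Solver.solve-∀

  residue : n % 4 ≡ 0
  residue = trans (cong (_% 4) shape) (remainder 0 (s +ℕ 1) 3 (ℕ.s≤s ℕ.z≤n))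

  quarter : n / 4 ≡ s +ℕ 1
  quarter = byShape 0 (s +ℕ 1) shape (ℕ.s≤s ℕ.z≤n)

  quarter+8 : (n +ℕ 8) / 4 ≡ 2 +ℕ (s +ℕ 1)
  quarter+8 = byShape 0 (2 +ℕ (s +ℕ 1)) (trans (cong (_+ℕ 8) shape) (ring s)) (ℕ.s≤s ℕ.z≤n)
    where ring : ∀ s → 0 +ℕ (s +ℕ 1) ℕ.* 4 +ℕ 8 ≡ 0 +ℕ (2 +ℕ (s +ℕ 1)) ℕ.* 4
          ring = ℕ-Solver.solve-∀

quarter : ∀ s d → d ≤ 1 → Numerics.n s d / 4 ≡ s +ℕ d
quarter s 0 _ = Shape₀.quarter s
quarter s 1 _ = Shape₁.quarter s
quarter s (ℕ.suc (ℕ.suc _)) (ℕ.s≤s ())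

PartI PartII : ℕ → ℕ → Set
PartI n q = (n % 4 ≡ 0 → + fixG n q ≡ + (2 ^ ((n +ℕ 2) / 2)) - + (2 ^ ((n +ℕ 8) / 4)) + + 1)
          × (n % 4 ≡ 2 → + fixG n q ≡ + (2 ^ ((n +ℕ 2) / 2)) - + (2 ^ ((n +ℕ 6) / 4)))
PartII n q = (m : ℕ) → 3 ≤ m → m ≤ n →
    (m % 2 ≡ 0 → + fixGm m n q ≡ + ((n / 2) C (m / 2)) - + 2 * + ((n / 4) C (m / 2)))
    × (m % 2 ≡ 1 → + fixGm m n q ≡ + 2 * + (((n / 2) ∸ 1) C (m / 2)) - + 2 * + ((n / 4) C (m / 2)))

-- Part (i) from the count fixG + 2^(e+2) + 1 = 2^(k+2) + 2^d: the two residues of n mod 4 are d = 1 and d = 0.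
partI : ∀ s d q → d ≤ 1 → let open LongRun s d in
        fixG (Numerics.n s d) q +ℕ 2 ^ (2 +ℕ e) +ℕ 1 ≡ 2 ^ (2 +ℕ k) +ℕ 2 ^ d → PartI (Numerics.n s d) q
partI s 0 q _ count = (λ r → contradiction (trans (sym (Shape₀.residue s)) r) λ ()) , λ _ →
  trans (ℤ-difference _ _ _ (ℕₚ.+-cancelʳ-≡ 1 _ _ count))
        (cong₂ (λ a b → + (2 ^ a) - + (2 ^ b)) (sym (Numerics.half+2 s 0)) (sym (Shape₀.quarter+6 s)))
partI s 1 q _ count = (λ _ → trans (ℤ-difference _ _ _ (ℕₚ.+-cancelʳ-≡ 1 _ _ (trans count (sym (ℕₚ.+-assoc K 1 1)))))
    (trans (cong (_- + E) (ℤₚ.pos-+ K 1)) (trans (reorder (+ K) (+ E))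
           (cong₂ (λ a b → + (2 ^ a) - + (2 ^ b) + + 1) (sym (Numerics.half+2 s 1)) (sym (Shape₁.quarter+8 s))))))
  , λ r → contradiction (trans (sym (Shape₁.residue s)) r) λ ()
  where
  open LongRun s 1
  E : ℕ
  E = 2 ^ (2 +ℕ e)
  K : ℕ
  K = 2 ^ (2 +ℕ k)
  reorder : ∀ a b → (a + + 1) - b ≡ a - b + + 1
  reorder = ℤ-Solver.solve-∀
partI s (ℕ.suc (ℕ.suc _)) q (ℕ.s≤s ()) count

partII : ∀ s d q → d ≤ 1 → let open LongRun s d in
  (∀ j₂ → let j = ℕ.suc (ℕ.suc j₂) in fixGm (j +ℕ j) (Numerics.n s d) q +ℕ (e C j +ℕ e C j) ≡ ℕ.suc k C j) →
  (∀ j → fixGm (ℕ.suc (j +ℕ j)) (Numerics.n s d) q +ℕ (e C j +ℕ e C j) ≡ k C j +ℕ k C j) →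
  PartII (Numerics.n s d) q
partII s d q d≤1 evenCount oddCount m 3≤m _ =
    (λ even → trans (cong (λ z → + fixGm z n q) (halving m 0 even)) (evenWeight j (subst (3 ≤_) (halving m 0 even) 3≤m)))
  , (λ odd → trans (cong (λ z → + fixGm z n q) (halving m 1 odd)) oddWeight)
  where
  open LongRun s d
  n = Numerics.n s d
  j : ℕ
  j = m / 2
  twice-e : ∀ i → + (e C i +ℕ e C i) ≡ + 2 * + ((n / 4) C i)
  twice-e i = trans (ℤ-twice (e C i)) (cong (λ z → + 2 * + (z C i)) (sym (quarter s d d≤1)))
  evenWeight : ∀ i → 3 ≤ i +ℕ i → + fixGm (i +ℕ i) n q ≡ + ((n / 2) C i) - + 2 * + ((n / 4) C i)
  evenWeight (ℕ.suc (ℕ.suc j₂)) _ = trans (ℤ-difference _ _ _ (evenCount j₂))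
    (cong₂ (λ a b → + (a C ℕ.suc (ℕ.suc j₂)) - b) (sym (Numerics.half s d)) (twice-e (ℕ.suc (ℕ.suc j₂))))
  evenWeight 0 ()
  evenWeight 1 (ℕ.s≤s (ℕ.s≤s ()))
  oddWeight : + fixGm (ℕ.suc (j +ℕ j)) n q ≡ + 2 * + (((n / 2) ∸ 1) C j) - + 2 * + ((n / 4) C j)
  oddWeight = trans (ℤ-difference _ _ _ (oddCount j))
    (cong₂ _-_ (trans (ℤ-twice (k C j)) (cong (λ z → + 2 * + ((z ∸ 1) C j)) (sym (Numerics.half s d)))) (twice-e j))

lemma3p7 : (n q : ℕ) → 4 ≤ n → n % 2 ≡ 0 → numFixedPoints n q ≡ 2 →
    ((n % 4 ≡ 0 → + fixG n q ≡ + (2 ^ ((n +ℕ 2) / 2)) - + (2 ^ ((n +ℕ 8) / 4)) + + 1)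
    × (n % 4 ≡ 2 → + fixG n q ≡ + (2 ^ ((n +ℕ 2) / 2)) - + (2 ^ ((n +ℕ 6) / 4))))
    × ((m : ℕ) → 3 ≤ m → m ≤ n →
    (m % 2 ≡ 0 → + fixGm m n q ≡ + ((n / 2) C (m / 2)) - + 2 * + ((n / 4) C (m / 2)))
    × (m % 2 ≡ 1 → + fixGm m n q ≡ + 2 * + (((n / 2) ∸ 1) C (m / 2)) - + 2 * + ((n / 4) C (m / 2))))
lemma3p7 n q 4≤n even two with evenShape n 4≤n even
... | s , d , d≤1 , k≥1 , refl = partI s d q d≤1 fixG-formula , partII s d q d≤1 fixGm-even fixGm-odd
  where
  open LongRun s d
  -- The reflection has fixed points, so it is i ↦ 2p − i.
  q≡2p : q ≡ q / 2 +ℕ q / 2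
  q≡2p = halving q 0 (even-reflection k q (subst (λ z → numFixedPoints z q ≡ 2) (double+2≡ k) two))
  open FixedCounts s d d≤1 k≥1 q (q / 2) q≡2p
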